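{- Let $n\ge 2$ and $j\in\{1,\dots,n-1\}$, and let $\bar{\mathcal{D}}_{n,j}=\{\sigma\in\mathcal{D}_n:\sigma(j)=n\}$, where $\mathcal{D}_n$ is the set of derangements of $[n]$. Then, with commuting indeterminates $x_1,\dots,x_n$, $$\sum_{\sigma\in\bar{\mathcal{D}}_{n,j}}(-1)^{\mathrm{cyc}(\sigma)}\prod_{i\in\mathrm{EXCi}(\sigma)}x_i=-x_1\cdots x_j.$$
   Context: A derangement of $[n]$ is a permutation with no fixed points. For a permutation $\sigma$ of $[n]$, $\mathrm{cyc}(\sigma)$ is its number of cycles and $\mathrm{EXCi}(\sigma)=\{i\in[n]:\sigma(i)>i\}$ is its set of excedance indices. -}

module Defs where

open import Level using (Level)
open import Data.Nat as ℕ using (ℕ; zero; suc)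
import Data.Nat.Properties as ℕP
open import Data.Fin using (Fin; toℕ; zero; suc) renaming (_<_ to _<ᶠ_; _≤_ to _≤ᶠ_)
open import Data.Fin.Properties using (_≟_; _<?_; _≤?_; all?)
open import Data.List using (List; []; _∷_; concatMap; map; filter; foldr; allFin)
open import Relation.Binary.PropositionalEquality using (_≡_)
open import Relation.Nullary using (Dec; ¬_; ¬?)
open import Relation.Nullary.Decidable using (_→-dec_; _×-dec_)
open import Data.Product using (_×_)
open import Algebra.Bundles using (CommutativeRing)

allFuns : (m n : ℕ) → List (Fin m → Fin n)
allFuns zero    n = (λ ()) ∷ []
allFuns (suc m) n = concatMap (λ a → map (cons a) (allFuns m n)) (allFin n)
  where
  cons : Fin n → (Fin m → Fin n) → Fin (suc m) → Fin n
  cons a f zero    = a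
  cons a f (suc i) = f i

-- Points of [n] are encoded by Fin n, the point i ∈ [n] being the element with toℕ = i - 1.

-- A function Fin n → Fin n is a permutation iff it is injective (finite set).
IsPermutation : ∀ {n} → (Fin n → Fin n) → Set
IsPermutation {n} σ = ∀ i k → σ i ≡ σ k → i ≡ k

isPermutation? : ∀ {n} (σ : Fin n → Fin n) → Dec (IsPermutation σ)
isPermutation? σ = all? λ i → all? λ k → (σ i ≟ σ k) →-dec (i ≟ k)

IsDerangement : ∀ {n} → (Fin n → Fin n) → Set
IsDerangement σ = IsPermutation σ × (∀ i → ¬ σ i ≡ i)

isDerangement? : ∀ {n} (σ : Fin n → Fin n) → Dec (IsDerangement σ)
isDerangement? σ = isPermutation? σ ×-dec all? (λ i → ¬? (σ i ≟ i))

-- σ(j) = n, in 1-based terms: the point with 1-based label j is sent to the point with label n.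
MapsTo : ∀ {n} → (Fin n → Fin n) → ℕ → Set
MapsTo {n} σ j = ∀ i → suc (toℕ i) ≡ j → suc (toℕ (σ i)) ≡ n

mapsTo? : ∀ {n} (σ : Fin n → Fin n) (j : ℕ) → Dec (MapsTo σ j)
mapsTo? {n} σ j = all? λ i → (suc (toℕ i) ℕ.≟ j) →-dec (suc (toℕ (σ i)) ℕ.≟ n)

InDbar : ∀ {n} → ℕ → (Fin n → Fin n) → Set
InDbar j σ = IsDerangement σ × MapsTo σ j

inDbar? : ∀ {n} (j : ℕ) (σ : Fin n → Fin n) → Dec (InDbar j σ)
inDbar? j σ = isDerangement? σ ×-dec mapsTo? σ j

Dbar : (n j : ℕ) → List (Fin n → Fin n)
Dbar n j = filter (inDbar? j) (allFuns n n)

iter : ∀ {n} → (Fin n → Fin n) → ℕ → Fin n → Fin n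
iter σ zero    i = i
iter σ (suc k) i = σ (iter σ k i)

-- i is the least element of its cycle (its orbit {σ^m(i)}; for a permutation of
-- an n-element set the exponents m < n already exhaust the orbit).
IsCycleMin : ∀ {n} → (Fin n → Fin n) → Fin n → Set
IsCycleMin {n} σ i = ∀ (m : Fin n) → i ≤ᶠ iter σ (toℕ m) i

isCycleMin? : ∀ {n} (σ : Fin n → Fin n) (i : Fin n) → Dec (IsCycleMin σ i)
isCycleMin? σ i = all? λ m → i ≤? iter σ (toℕ m) i

-- number of cycles = number of orbits = number of orbit minima
cyc : ∀ {n} → (Fin n → Fin n) → ℕ
cyc {n} σ = Data.List.length (filter (isCycleMin? σ) (allFin n))

EXCi : ∀ {n} → (Fin n → Fin n) → List (Fin n)
EXCi {n} σ = filter (λ i → i <? σ i) (allFin n)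

module _ {c ℓ : Level} (R : CommutativeRing c ℓ) where
  open CommutativeRing R

  negOnePow : ℕ → Carrier
  negOnePow zero    = 1#
  negOnePow (suc k) = - negOnePow k

  sumR : List Carrier → Carrier
  sumR = foldr _+_ 0#

  prodR : List Carrier → Carrier
  prodR = foldr _*_ 1#

  lhsSum : (n j : ℕ) → (Fin n → Carrier) → Carrier
  lhsSum n j x = sumR (map (λ σ → negOnePow (cyc σ) * prodR (map x (EXCi σ))) (Dbar n j))

  -- x_1 ⋯ x_j  (1-based labels 1..j are the Fin elements with toℕ < j)
  prefixProd : (n j : ℕ) → (Fin n → Carrier) → Carrier
  prefixProd n j x = prodR (map x (filter (λ i → suc (toℕ i) ℕ.≤? j) (allFin n)))

{-# OPTIONS --safe #-}
-- Weight a permutation σ of [n] by ∏ᵢ W i (σ i), where W is the excedance matrix (x_i above the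
-- diagonal, 0 on it, 1 below it) with row j replaced by x_j e_n. The weight is ∏_{i ∈ EXCi σ} x_i when σ is
-- a derangement with σ(j) = n and 0 otherwise, so the sum is the cycle sum Σ_σ (−1)^{cyc σ} ∏ᵢ W i (σ i),
-- i.e. det(−W). Expanding it along the last column (n is either fixed or inserted in a cycle after some q)
-- leaves the excedance matrix of size n − 1 with row j replaced by a row of ones. For the excedance matrix
-- of size m with a set T of rows replaced by ones the cycle sum is x_1⋯x_m − Σ_k x_1⋯x_k if T = ∅,
-- −x_1⋯x_{r−1} if T = {r}, and 0 if T has two elements; the three cases are proved together by the same
-- expansion.
module Submission where

open import Defs
open import Level using (Level; _⊔_)
open import Data.Nat as ℕ using (ℕ; zero; suc; _≤_; _<_)
import Data.Nat.Properties as ℕ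
open import Data.Fin as Fin using (Fin; zero; suc; toℕ; inject₁; fromℕ; fromℕ<; punchIn; punchOut)
open import Data.Fin.Properties
  using ( _≟_; all?; any?; <-cmp; <⇒≢; suc-injective; inject₁-injective; toℕ-injective; toℕ-inject₁; toℕ-fromℕ
        ; toℕ-fromℕ<; fromℕ≢inject₁; ≤fromℕ; toℕ<n; pigeonhole; punchOut-injective; punchInᵢ≢i )
open import Data.Bool using (Bool; true; false; if_then_else_)
open import Data.Bool.Properties using (if-swap-then)
open import Data.List using (List; []; _∷_; _++_; length; map; filter; concatMap; tabulate; allFin)
open import Data.List.Properties using (filter-accept; filter-reject; map-∘; map-tabulate)
open import Data.Product using (_×_; _,_; proj₁; proj₂; ∃; ∃₂)
open import Data.Sum using (_⊎_; inj₁; inj₂; [_,_]′)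
open import Data.Vec.Functional using (Vector; removeAt; replicate; updateAt)
open import Data.Vec.Functional.Properties using (updateAt-updates; updateAt-minimal)
open import Function using (_∘_; id; const; _⇔_; mk⇔; Equivalence)
import Relation.Binary.PropositionalEquality as ≡
open ≡ using (_≡_; _≢_; _≗_)
open import Relation.Binary.Definitions using (tri<; tri≈; tri>)
open import Relation.Nullary using (Dec; yes; no; ¬_; does; contradiction)
open import Relation.Nullary.Decidable using (dec-true; dec-false; does-⇔)
open import Relation.Unary using (Pred; Decidable)
open import Algebra.Bundles using (CommutativeRing)

data LastView {m : ℕ} : Fin (suc m) → Set where
  init-view : (i : Fin m) → LastView (inject₁ i)
  last-view : LastView (fromℕ m)

lastView : ∀ {m} (k : Fin (suc m)) → LastView k
lastView {zero}  zero    = last-view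
lastView {suc m} zero    = init-view zero
lastView {suc m} (suc k) with lastView k
... | init-view i = init-view (suc i)
... | last-view   = last-view

caseLast : ∀ {m} {A : Set} → (Fin m → A) → A → Fin (suc m) → A
caseLast {zero}  f a zero    = a
caseLast {suc m} f a zero    = f zero
caseLast {suc m} f a (suc k) = caseLast (f ∘ suc) a k

caseLast-inject₁ : ∀ {m} {A : Set} (f : Fin m → A) a i → caseLast f a (inject₁ i) ≡ f i
caseLast-inject₁ f a zero    = ≡.refl
caseLast-inject₁ f a (suc i) = caseLast-inject₁ (f ∘ suc) a i

caseLast-fromℕ : ∀ {m} {A : Set} (f : Fin m → A) a → caseLast f a (fromℕ m) ≡ a
caseLast-fromℕ {zero}  f a = ≡.refl
caseLast-fromℕ {suc m} f a = caseLast-fromℕ (f ∘ suc) a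

inject₁≢fromℕ : ∀ {m} (i : Fin m) → inject₁ i ≢ fromℕ m
inject₁≢fromℕ i = fromℕ≢inject₁ ∘ ≡.sym

inject₁-mono-≤ : ∀ {m} {i j : Fin m} → i Fin.≤ j → inject₁ i Fin.≤ inject₁ j
inject₁-mono-≤ {i = i} {j} i≤j rewrite toℕ-inject₁ i | toℕ-inject₁ j = i≤j

inject₁-cancel-≤ : ∀ {m} {i j : Fin m} → inject₁ i Fin.≤ inject₁ j → i Fin.≤ j
inject₁-cancel-≤ {i = i} {j} i≤j rewrite toℕ-inject₁ i | toℕ-inject₁ j = i≤j

fromℕ≰inject₁ : ∀ {m} (i : Fin m) → ¬ fromℕ m Fin.≤ inject₁ i
fromℕ≰inject₁ {m} i le rewrite toℕ-fromℕ m | toℕ-inject₁ i = ℕ.<⇒≱ (toℕ<n i) le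

inject₁-mono-< : ∀ {m} {i j : Fin m} → i Fin.< j → inject₁ i Fin.< inject₁ j
inject₁-mono-< {i = i} {j} i<j rewrite toℕ-inject₁ i | toℕ-inject₁ j = i<j

inject₁<fromℕ : ∀ {m} (i : Fin m) → inject₁ i Fin.< fromℕ m
inject₁<fromℕ {m} i rewrite toℕ-inject₁ i | toℕ-fromℕ m = toℕ<n i

-- A permutation of Fin (suc m) either fixes the last point (extend τ) or sends some q to it
-- (insertAfter q τ : q ↦ last ↦ τ q); contract removes the last point from its cycle, falling back
-- to i only when σ is not injective.
extend : ∀ {m} → (Fin m → Fin m) → Fin (suc m) → Fin (suc m)
extend {m} τ = caseLast (inject₁ ∘ τ) (fromℕ m)

insertAfter : ∀ {m} → Fin m → (Fin m → Fin m) → Fin (suc m) → Fin (suc m)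
insertAfter {m} q τ = caseLast (updateAt (inject₁ ∘ τ) q (const (fromℕ m))) (inject₁ (τ q))

contract : ∀ {m} → (Fin (suc m) → Fin (suc m)) → Fin m → Fin m
contract {m} σ i = caseLast id (caseLast id i (σ (fromℕ m))) (σ (inject₁ i))

extend-inject₁ : ∀ {m} (τ : Fin m → Fin m) i → extend τ (inject₁ i) ≡ inject₁ (τ i)
extend-inject₁ τ = caseLast-inject₁ _ _

extend-fromℕ : ∀ {m} (τ : Fin m → Fin m) → extend τ (fromℕ m) ≡ fromℕ m
extend-fromℕ τ = caseLast-fromℕ (inject₁ ∘ τ) _

insertAfter-fromℕ : ∀ {m} q (τ : Fin m → Fin m) → insertAfter q τ (fromℕ m) ≡ inject₁ (τ q)
insertAfter-fromℕ {m} q τ = caseLast-fromℕ (updateAt (inject₁ ∘ τ) q (const (fromℕ m))) _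

insertAfter-at : ∀ {m} q (τ : Fin m → Fin m) → insertAfter q τ (inject₁ q) ≡ fromℕ m
insertAfter-at q τ = ≡.trans (caseLast-inject₁ _ _ q) (updateAt-updates q (inject₁ ∘ τ))

insertAfter-inject₁ : ∀ {m} q (τ : Fin m → Fin m) {i} → i ≢ q → insertAfter q τ (inject₁ i) ≡ inject₁ (τ i)
insertAfter-inject₁ q τ {i} i≢q = ≡.trans (caseLast-inject₁ _ _ i) (updateAt-minimal i q (inject₁ ∘ τ) i≢q)

contract-direct : ∀ {m} (σ : Fin (suc m) → Fin (suc m)) {i v} → σ (inject₁ i) ≡ inject₁ v → contract σ i ≡ v
contract-direct σ {v = v} e rewrite e = caseLast-inject₁ id _ v

contract-via-last : ∀ {m} (σ : Fin (suc m) → Fin (suc m)) {i v} →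
  σ (inject₁ i) ≡ fromℕ m → σ (fromℕ m) ≡ inject₁ v → contract σ i ≡ v
contract-via-last {m} σ {i} {v} e e′ rewrite e | e′ =
  ≡.trans (caseLast-fromℕ id _) (caseLast-inject₁ id i v)

data ContractSpec {m} (σ : Fin (suc m) → Fin (suc m)) (i : Fin m) : Set where
  direct   : σ (inject₁ i) ≡ inject₁ (contract σ i) → ContractSpec σ i
  via-last : σ (inject₁ i) ≡ fromℕ m → σ (fromℕ m) ≡ inject₁ (contract σ i) → ContractSpec σ i

contractSpec : ∀ {m} (σ : Fin (suc m) → Fin (suc m)) → IsPermutation σ → ∀ i → ContractSpec σ i
contractSpec {m} σ σ-inj i with σ (inject₁ i) in e | lastView (σ (inject₁ i))
... | _ | init-view v = direct (≡.trans e (≡.cong inject₁ (≡.sym (contract-direct σ e))))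
... | _ | last-view with σ (fromℕ m) in e′ | lastView (σ (fromℕ m))
...   | _ | init-view v = via-last e (≡.trans e′ (≡.cong inject₁ (≡.sym (contract-via-last σ e e′))))
...   | _ | last-view   = contradiction (σ-inj _ _ (≡.trans e (≡.sym e′))) (inject₁≢fromℕ i)

extend-injective : ∀ {m} (τ : Fin m → Fin m) → IsPermutation τ → IsPermutation (extend τ)
extend-injective τ τ-inj a b e with lastView a | lastView b
... | init-view i | init-view k =
  ≡.cong inject₁ (τ-inj i k (inject₁-injective (≡.trans (≡.sym (extend-inject₁ τ i)) (≡.trans e (extend-inject₁ τ k)))))
... | init-view i | last-view =
  contradiction (≡.trans (≡.sym (extend-inject₁ τ i)) (≡.trans e (extend-fromℕ τ))) (inject₁≢fromℕ (τ i))
... | last-view | init-view k =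
  contradiction (≡.trans (≡.sym (extend-inject₁ τ k)) (≡.trans (≡.sym e) (extend-fromℕ τ))) (inject₁≢fromℕ (τ k))
... | last-view | last-view = ≡.refl

insertAfter-inject₁≢fromℕ : ∀ {m} q (τ : Fin m → Fin m) → IsPermutation τ →
  ∀ i → insertAfter q τ (inject₁ i) ≢ insertAfter q τ (fromℕ m)
insertAfter-inject₁≢fromℕ q τ τ-inj i e with i ≟ q
... | yes ≡.refl = inject₁≢fromℕ (τ q) (≡.trans (≡.sym (insertAfter-fromℕ q τ)) (≡.trans (≡.sym e) (insertAfter-at q τ)))
... | no i≢q   = i≢q (τ-inj i q (inject₁-injective
                   (≡.trans (≡.sym (insertAfter-inject₁ q τ i≢q)) (≡.trans e (insertAfter-fromℕ q τ)))))

insertAfter-injective : ∀ {m} q (τ : Fin m → Fin m) → IsPermutation τ → IsPermutation (insertAfter q τ)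
insertAfter-injective {m} q τ τ-inj a b e with lastView a | lastView b
... | init-view i | init-view k = ≡.cong inject₁ (on-init i k e)
  where
  on-init : ∀ i k → insertAfter q τ (inject₁ i) ≡ insertAfter q τ (inject₁ k) → i ≡ k
  on-init i k e with i ≟ q | k ≟ q
  ... | yes i≡q | yes k≡q = ≡.trans i≡q (≡.sym k≡q)
  ... | yes ≡.refl | no k≢q =
    contradiction (≡.trans (≡.sym (insertAfter-at q τ)) (≡.trans e (insertAfter-inject₁ q τ k≢q))) (inject₁≢fromℕ (τ k) ∘ ≡.sym)
  ... | no i≢q | yes ≡.refl =
    contradiction (≡.trans (≡.sym (insertAfter-inject₁ q τ i≢q)) (≡.trans e (insertAfter-at q τ))) (inject₁≢fromℕ (τ i))
  ... | no i≢q | no k≢q =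
    τ-inj i k (inject₁-injective (≡.trans (≡.sym (insertAfter-inject₁ q τ i≢q)) (≡.trans e (insertAfter-inject₁ q τ k≢q))))
... | init-view i | last-view = contradiction e (insertAfter-inject₁≢fromℕ q τ τ-inj i)
... | last-view | init-view k = contradiction (≡.sym e) (insertAfter-inject₁≢fromℕ q τ τ-inj k)
... | last-view | last-view = ≡.refl

contract-injective : ∀ {m} (σ : Fin (suc m) → Fin (suc m)) → IsPermutation σ → IsPermutation (contract σ)
contract-injective σ σ-inj i k e with contractSpec σ σ-inj i | contractSpec σ σ-inj k
... | direct a | direct b = inject₁-injective (σ-inj _ _ (≡.trans a (≡.trans (≡.cong inject₁ e) (≡.sym b))))
... | direct a | via-last _ b =
  contradiction (σ-inj _ _ (≡.trans a (≡.trans (≡.cong inject₁ e) (≡.sym b)))) (inject₁≢fromℕ i)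
... | via-last _ a | direct b =
  contradiction (σ-inj _ _ (≡.trans b (≡.trans (≡.cong inject₁ (≡.sym e)) (≡.sym a)))) (inject₁≢fromℕ k)
... | via-last a _ | via-last b _ = inject₁-injective (σ-inj _ _ (≡.trans a (≡.sym b)))

contract-extend : ∀ {m} (τ : Fin m → Fin m) → contract (extend τ) ≗ τ
contract-extend τ i = contract-direct (extend τ) (extend-inject₁ τ i)

contract-insertAfter : ∀ {m} q (τ : Fin m → Fin m) → contract (insertAfter q τ) ≗ τ
contract-insertAfter q τ i with i ≟ q
... | yes ≡.refl = contract-via-last (insertAfter q τ) (insertAfter-at q τ) (insertAfter-fromℕ q τ)
... | no i≢q   = contract-direct (insertAfter q τ) (insertAfter-inject₁ q τ i≢q)

extend-contract : ∀ {m} (σ : Fin (suc m) → Fin (suc m)) → IsPermutation σ →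
  σ (fromℕ m) ≡ fromℕ m → extend (contract σ) ≗ σ
extend-contract σ σ-inj σ-last k with lastView k
... | last-view   = ≡.trans (extend-fromℕ _) (≡.sym σ-last)
... | init-view i with contractSpec σ σ-inj i
...   | direct a     = ≡.trans (extend-inject₁ _ i) (≡.sym a)
...   | via-last a _ = contradiction (σ-inj _ _ (≡.trans a (≡.sym σ-last))) (inject₁≢fromℕ i)

insertAfter-contract : ∀ {m} q (σ : Fin (suc m) → Fin (suc m)) → IsPermutation σ →
  σ (inject₁ q) ≡ fromℕ m → insertAfter q (contract σ) ≗ σ
insertAfter-contract q σ σ-inj σq k with lastView k
... | last-view with contractSpec σ σ-inj q
...   | direct a     = contradiction (≡.trans (≡.sym a) σq) (inject₁≢fromℕ _)
...   | via-last _ a = ≡.trans (insertAfter-fromℕ q _) (≡.sym a)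
insertAfter-contract q σ σ-inj σq k | init-view i with i ≟ q
... | yes ≡.refl = ≡.trans (insertAfter-at q _) (≡.sym σq)
... | no i≢q with contractSpec σ σ-inj i
...   | direct a     = ≡.trans (insertAfter-inject₁ q _ i≢q) (≡.sym a)
...   | via-last a _ = contradiction (inject₁-injective (σ-inj _ _ (≡.trans a (≡.sym σq)))) i≢q

extend-cong : ∀ {m} {τ τ′ : Fin m → Fin m} → τ ≗ τ′ → extend τ ≗ extend τ′
extend-cong {τ = τ} {τ′} e k with lastView k
... | init-view i = ≡.trans (extend-inject₁ τ i) (≡.trans (≡.cong inject₁ (e i)) (≡.sym (extend-inject₁ τ′ i)))
... | last-view   = ≡.trans (extend-fromℕ τ) (≡.sym (extend-fromℕ τ′))

insertAfter-cong : ∀ {m} q {τ τ′ : Fin m → Fin m} → τ ≗ τ′ → insertAfter q τ ≗ insertAfter q τ′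
insertAfter-cong q {τ} {τ′} e k with lastView k
... | last-view = ≡.trans (insertAfter-fromℕ q τ) (≡.trans (≡.cong inject₁ (e q)) (≡.sym (insertAfter-fromℕ q τ′)))
... | init-view i with i ≟ q
...   | yes ≡.refl = ≡.trans (insertAfter-at q τ) (≡.sym (insertAfter-at q τ′))
...   | no i≢q   = ≡.trans (insertAfter-inject₁ q τ i≢q)
                     (≡.trans (≡.cong inject₁ (e i)) (≡.sym (insertAfter-inject₁ q τ′ i≢q)))

contract-cong : ∀ {m} {σ σ′ : Fin (suc m) → Fin (suc m)} → σ ≗ σ′ → contract σ ≗ contract σ′
contract-cong {m} e i rewrite e (inject₁ i) | e (fromℕ m) = ≡.refl

injective⇒surjective : ∀ {n} (σ : Fin n → Fin n) → IsPermutation σ → ∀ y → ∃ λ k → σ k ≡ y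
injective⇒surjective {zero}  σ σ-inj ()
injective⇒surjective {suc n} σ σ-inj y with any? (λ k → σ k ≟ y)
... | yes hit = hit
... | no miss with pigeonhole (ℕ.n<1+n n) (λ k → punchOut {i = y} {j = σ k} (λ e → miss (k , ≡.sym e)))
...   | i , j , i<j , e =
  contradiction (σ-inj i j (punchOut-injective (λ e′ → miss (i , ≡.sym e′)) (λ e′ → miss (j , ≡.sym e′)) e)) (<⇒≢ i<j)

-- Orbits and the number of cycles

iter-+ : ∀ {n} (σ : Fin n → Fin n) a b i → iter σ (a ℕ.+ b) i ≡ iter σ a (iter σ b i)
iter-+ σ zero    b i = ≡.refl
iter-+ σ (suc a) b i = ≡.cong σ (iter-+ σ a b i)

iter-cong : ∀ {n} {σ σ′ : Fin n → Fin n} → σ ≗ σ′ → ∀ t i → iter σ t i ≡ iter σ′ t i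
iter-cong e zero    i = ≡.refl
iter-cong {σ′ = σ′} e (suc t) i = ≡.trans (e _) (≡.cong σ′ (iter-cong e t i))

iter-period : ∀ {n} (σ : Fin n → Fin n) → IsPermutation σ →
  ∀ i → ∃ λ d → 0 ℕ.< d × d ℕ.≤ n × iter σ d i ≡ i
iter-period {n} σ σ-inj i with pigeonhole (ℕ.n<1+n n) (λ k → iter σ (toℕ k) i)
... | a , b , a<b , e = d , ℕ.m<n⇒0<n∸m a<b ,
  ℕ.≤-trans (ℕ.m∸n≤m (toℕ b) (toℕ a)) (ℕ.≤-pred (toℕ<n b)) , cancel (toℕ a) (begin
    iter σ (toℕ a) (iter σ d i) ≡⟨ iter-+ σ (toℕ a) d i ⟨
    iter σ (toℕ a ℕ.+ d) i      ≡⟨ ≡.cong (λ t → iter σ t i) (ℕ.m+[n∸m]≡n (ℕ.<⇒≤ a<b)) ⟩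
    iter σ (toℕ b) i            ≡⟨ e ⟨
    iter σ (toℕ a) i            ∎)
  where
  open ≡.≡-Reasoning
  d : ℕ
  d = toℕ b ℕ.∸ toℕ a
  cancel : ∀ t {x y} → iter σ t x ≡ iter σ t y → x ≡ y
  cancel zero    e = e
  cancel (suc t) e = cancel t (σ-inj _ _ e)

iter-reduce : ∀ {n} (σ : Fin n → Fin n) {d i} → 0 ℕ.< d → iter σ d i ≡ i →
  ∀ t → ∃ λ s → s ℕ.< d × iter σ t i ≡ iter σ s i
iter-reduce σ 0<d period zero = 0 , 0<d , ≡.refl
iter-reduce σ {i = i} 0<d period (suc t) with iter-reduce σ 0<d period t
... | s , s<d , e with ℕ.m≤n⇒m<n∨m≡n s<d
...   | inj₁ 1+s<d = suc s , 1+s<d , ≡.cong σ e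
...   | inj₂ 1+s≡d = 0 , 0<d , ≡.trans (≡.cong σ e) (≡.trans (≡.cong (λ u → iter σ u i) 1+s≡d) period)

iter-below : ∀ {n} (σ : Fin n → Fin n) → IsPermutation σ →
  ∀ i t → ∃ λ (s : Fin n) → iter σ t i ≡ iter σ (toℕ s) i
iter-below σ σ-inj i t with iter-period σ σ-inj i
... | d , 0<d , d≤n , period with iter-reduce σ 0<d period t
...   | s , s<d , e = fromℕ< s<n , ≡.trans e (≡.cong (λ u → iter σ u i) (≡.sym (toℕ-fromℕ< s<n)))
  where
  s<n : s ℕ.< _
  s<n = ℕ.<-≤-trans s<d d≤n

IsOrbitMin : ∀ {n} → (Fin n → Fin n) → Fin n → Set
IsOrbitMin σ i = ∀ t → i Fin.≤ iter σ t i

isCycleMin⇒isOrbitMin : ∀ {n} (σ : Fin n → Fin n) → IsPermutation σ → ∀ {i} → IsCycleMin σ i → IsOrbitMin σ i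
isCycleMin⇒isOrbitMin σ σ-inj {i} min t with iter-below σ σ-inj i t
... | s , e = ≡.subst (i Fin.≤_) (≡.sym e) (min s)

isOrbitMin⇒isCycleMin : ∀ {n} (σ : Fin n → Fin n) {i} → IsOrbitMin σ i → IsCycleMin σ i
isOrbitMin⇒isCycleMin σ min = min ∘ toℕ

module _ {a p} {A : Set a} {P : Pred A p} (P? : Decidable P) where

  length-filter-tabulate-last : ∀ {m} (f : Fin (suc m) → A) →
    length (filter P? (tabulate f)) ≡ length (filter P? (tabulate (f ∘ inject₁))) ℕ.+ length (filter P? (f (fromℕ m) ∷ []))
  length-filter-tabulate-last {zero}  f = ≡.refl
  length-filter-tabulate-last {suc m} f with P? (f zero)
  ... | yes _ = ≡.cong suc (length-filter-tabulate-last (f ∘ suc))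
  ... | no  _ = length-filter-tabulate-last (f ∘ suc)

  module _ {b q} {B : Set b} {Q : Pred B q} (Q? : Decidable Q) where

    length-filter-tabulate-≐ : ∀ {m} (f : Fin m → A) (g : Fin m → B) →
      (∀ i → P (f i) → Q (g i)) → (∀ i → Q (g i) → P (f i)) →
      length (filter P? (tabulate f)) ≡ length (filter Q? (tabulate g))
    length-filter-tabulate-≐ {zero}  f g P⇒Q Q⇒P = ≡.refl
    length-filter-tabulate-≐ {suc m} f g P⇒Q Q⇒P with P? (f zero) | Q? (g zero)
    ... | yes _  | yes _  = ≡.cong suc (length-filter-tabulate-≐ (f ∘ suc) (g ∘ suc) (P⇒Q ∘ suc) (Q⇒P ∘ suc))
    ... | yes Pf | no ¬Qg = contradiction (P⇒Q zero Pf) ¬Qg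
    ... | no ¬Pf | yes Qg = contradiction (Q⇒P zero Qg) ¬Pf
    ... | no  _  | no  _  = length-filter-tabulate-≐ (f ∘ suc) (g ∘ suc) (P⇒Q ∘ suc) (Q⇒P ∘ suc)

cyc-cong : ∀ {n} {σ σ′ : Fin n → Fin n} → σ ≗ σ′ → cyc σ ≡ cyc σ′
cyc-cong {σ = σ} {σ′} e = length-filter-tabulate-≐ (isCycleMin? σ) (isCycleMin? σ′) id id
  (λ i min s → ≡.subst (i Fin.≤_) (iter-cong e (toℕ s) i) (min s))
  (λ i min s → ≡.subst (i Fin.≤_) (≡.sym (iter-cong e (toℕ s) i)) (min s))

module _ {m} (τ : Fin m → Fin m) (τ-inj : IsPermutation τ) where

  iter-extend-inject₁ : ∀ t i → iter (extend τ) t (inject₁ i) ≡ inject₁ (iter τ t i)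
  iter-extend-inject₁ zero    i = ≡.refl
  iter-extend-inject₁ (suc t) i = ≡.trans (≡.cong (extend τ) (iter-extend-inject₁ t i)) (extend-inject₁ τ _)

  iter-extend-fromℕ : ∀ t → iter (extend τ) t (fromℕ m) ≡ fromℕ m
  iter-extend-fromℕ zero    = ≡.refl
  iter-extend-fromℕ (suc t) = ≡.trans (≡.cong (extend τ) (iter-extend-fromℕ t)) (extend-fromℕ τ)

  cyc-extend : cyc (extend τ) ≡ suc (cyc τ)
  cyc-extend = begin
    cyc (extend τ)
      ≡⟨ length-filter-tabulate-last (isCycleMin? (extend τ)) id ⟩
    length (filter (isCycleMin? (extend τ)) (tabulate inject₁)) ℕ.+ length (filter (isCycleMin? (extend τ)) (fromℕ m ∷ []))
      ≡⟨ ≡.cong₂ ℕ._+_ (length-filter-tabulate-≐ (isCycleMin? (extend τ)) (isCycleMin? τ) inject₁ id min-inject₁ inject₁-min)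
                   (≡.cong length (filter-accept (isCycleMin? (extend τ)) last-min)) ⟩
    cyc τ ℕ.+ 1
      ≡⟨ ℕ.+-comm (cyc τ) 1 ⟩
    suc (cyc τ) ∎
    where
    open ≡.≡-Reasoning
    min-inject₁ : ∀ i → IsCycleMin (extend τ) (inject₁ i) → IsCycleMin τ i
    min-inject₁ i min = isOrbitMin⇒isCycleMin τ λ t → inject₁-cancel-≤
      (≡.subst (inject₁ i Fin.≤_) (iter-extend-inject₁ t i) (isCycleMin⇒isOrbitMin (extend τ) (extend-injective τ τ-inj) min t))
    inject₁-min : ∀ i → IsCycleMin τ i → IsCycleMin (extend τ) (inject₁ i)
    inject₁-min i min = isOrbitMin⇒isCycleMin (extend τ) λ t →
      ≡.subst (inject₁ i Fin.≤_) (≡.sym (iter-extend-inject₁ t i)) (inject₁-mono-≤ (isCycleMin⇒isOrbitMin τ τ-inj min t))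
    last-min : IsCycleMin (extend τ) (fromℕ m)
    last-min = isOrbitMin⇒isCycleMin (extend τ) λ t → ≡.subst (fromℕ m Fin.≤_) (≡.sym (iter-extend-fromℕ t)) (≤fromℕ _)

module _ {m} (q : Fin m) (τ : Fin m → Fin m) (τ-inj : IsPermutation τ) where

  private
    σ : Fin (suc m) → Fin (suc m)
    σ = insertAfter q τ

  iter-insertAfter-visits : ∀ i t → ∃ λ t′ → iter σ t′ (inject₁ i) ≡ inject₁ (iter τ t i)
  iter-insertAfter-visits i zero = 0 , ≡.refl
  iter-insertAfter-visits i (suc t) with iter-insertAfter-visits i t | iter τ t i ≟ q
  ... | t′ , e | yes ≡.refl =
    suc (suc t′) , ≡.trans (≡.cong (σ ∘ σ) e) (≡.trans (≡.cong σ (insertAfter-at q τ)) (insertAfter-fromℕ q τ))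
  ... | t′ , e | no  ≢q   = suc t′ , ≡.trans (≡.cong σ e) (insertAfter-inject₁ q τ ≢q)

  iter-insertAfter-inject₁-or-last : ∀ i t →
    (∃ λ s → iter σ t (inject₁ i) ≡ inject₁ (iter τ s i)) ⊎ (∃ λ s → iter τ s i ≡ q × iter σ t (inject₁ i) ≡ fromℕ m)
  iter-insertAfter-inject₁-or-last i zero = inj₁ (0 , ≡.refl)
  iter-insertAfter-inject₁-or-last i (suc t) with iter-insertAfter-inject₁-or-last i t
  ... | inj₂ (s , ≡.refl , e) = inj₁ (suc s , ≡.trans (≡.cong σ e) (insertAfter-fromℕ q τ))
  ... | inj₁ (s , e) with iter τ s i ≟ q
  ...   | yes ≡.refl = inj₂ (s , ≡.refl , ≡.trans (≡.cong σ e) (insertAfter-at q τ))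
  ...   | no  ≢q   = inj₁ (suc s , ≡.trans (≡.cong σ e) (insertAfter-inject₁ q τ ≢q))

  cyc-insertAfter : cyc σ ≡ cyc τ
  cyc-insertAfter = begin
    cyc σ
      ≡⟨ length-filter-tabulate-last (isCycleMin? σ) id ⟩
    length (filter (isCycleMin? σ) (tabulate inject₁)) ℕ.+ length (filter (isCycleMin? σ) (fromℕ m ∷ []))
      ≡⟨ ≡.cong₂ ℕ._+_ (length-filter-tabulate-≐ (isCycleMin? σ) (isCycleMin? τ) inject₁ id min-inject₁ inject₁-min)
                   (≡.cong length (filter-reject (isCycleMin? σ) last-not-min)) ⟩
    cyc τ ℕ.+ 0
      ≡⟨ ℕ.+-identityʳ (cyc τ) ⟩
    cyc τ ∎
    where
    open ≡.≡-Reasoning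
    σ-inj : IsPermutation σ
    σ-inj = insertAfter-injective q τ τ-inj
    min-inject₁ : ∀ i → IsCycleMin σ (inject₁ i) → IsCycleMin τ i
    min-inject₁ i min = isOrbitMin⇒isCycleMin τ λ t → let t′ , e = iter-insertAfter-visits i t in
      inject₁-cancel-≤ (≡.subst (inject₁ i Fin.≤_) e (isCycleMin⇒isOrbitMin σ σ-inj min t′))
    inject₁-min : ∀ i → IsCycleMin τ i → IsCycleMin σ (inject₁ i)
    inject₁-min i min = isOrbitMin⇒isCycleMin σ λ t →
      [ (λ (s , e) → ≡.subst (inject₁ i Fin.≤_) (≡.sym e) (inject₁-mono-≤ (isCycleMin⇒isOrbitMin τ τ-inj min s)))
      , (λ (_ , _ , e) → ≡.subst (inject₁ i Fin.≤_) (≡.sym e) (≤fromℕ _))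
      ]′ (iter-insertAfter-inject₁-or-last i t)
    last-not-min : ¬ IsCycleMin σ (fromℕ m)
    last-not-min min = fromℕ≰inject₁ (τ q) (≡.subst (fromℕ m Fin.≤_) (insertAfter-fromℕ q τ) (isCycleMin⇒isOrbitMin σ σ-inj min 1))

IsEmpty : ∀ {m} → (Fin m → Bool) → Set
IsEmpty T = ∀ i → T i ≡ false

IsSingleton : ∀ {m} → (Fin m → Bool) → Fin m → Set
IsSingleton T r = T r ≡ true × (∀ i → T i ≡ true → i ≡ r)

HasTwoElements : ∀ {m} → (Fin m → Bool) → Set
HasTwoElements T = ∃₂ λ a b → a ≢ b × T a ≡ true × T b ≡ true

isEmpty⊎isSingleton⊎hasTwoElements : ∀ {m} (T : Fin m → Bool) → IsEmpty T ⊎ (∃ λ r → IsSingleton T r) ⊎ HasTwoElements T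
isEmpty⊎isSingleton⊎hasTwoElements {zero}  T = inj₁ λ ()
isEmpty⊎isSingleton⊎hasTwoElements {suc m} T with isEmpty⊎isSingleton⊎hasTwoElements (T ∘ suc) | T zero in T₀
... | inj₁ ∅ | false = inj₁ λ { zero → T₀ ; (suc i) → ∅ i }
... | inj₁ ∅ | true  = inj₂ (inj₁ (zero , T₀ , λ { zero _ → ≡.refl ; (suc i) Ti → contradiction (≡.trans (≡.sym Ti) (∅ i)) λ () }))
... | inj₂ (inj₁ (r , Tr , unique)) | false =
  inj₂ (inj₁ (suc r , Tr , λ { zero T₀′ → contradiction (≡.trans (≡.sym T₀′) T₀) λ () ; (suc i) Ti → ≡.cong suc (unique i Ti) }))
... | inj₂ (inj₁ (r , Tr , _)) | true = inj₂ (inj₂ (zero , suc r , (λ ()) , T₀ , Tr))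
... | inj₂ (inj₂ (a , b , a≢b , Ta , Tb)) | _ = inj₂ (inj₂ (suc a , suc b , a≢b ∘ suc-injective , Ta , Tb))

module _ {m} (T : Fin m → Bool) where

  private
    insert : Fin m → Fin m → Bool
    insert q = updateAt T q (const true)

  insert-isEmpty : IsEmpty T → ∀ q → IsSingleton (insert q) q
  insert-isEmpty ∅ q = updateAt-updates q T , λ i Ti → onlyQ i Ti
    where
    onlyQ : ∀ i → insert q i ≡ true → i ≡ q
    onlyQ i Ti with i ≟ q
    ... | yes i≡q = i≡q
    ... | no  i≢q = contradiction (≡.trans (≡.sym Ti) (≡.trans (updateAt-minimal i q T i≢q) (∅ i))) λ ()

  insert-isSingleton : ∀ {r} → IsSingleton T r → IsSingleton (insert r) r
  insert-isSingleton {r} (_ , unique) = updateAt-updates r T , onlyR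
    where
    onlyR : ∀ i → insert r i ≡ true → i ≡ r
    onlyR i Ti with i ≟ r
    ... | yes i≡r = i≡r
    ... | no  i≢r = unique i (≡.trans (≡.sym (updateAt-minimal i r T i≢r)) Ti)

  insert-isSingleton-other : ∀ {r q} → IsSingleton T r → q ≢ r → HasTwoElements (insert q)
  insert-isSingleton-other {r} {q} (Tr , _) q≢r =
    q , r , q≢r , updateAt-updates q T , ≡.trans (updateAt-minimal r q T (q≢r ∘ ≡.sym)) Tr

  insert-hasTwoElements : HasTwoElements T → ∀ q → HasTwoElements (insert q)
  insert-hasTwoElements (a , b , a≢b , Ta , Tb) q = a , b , a≢b , stays a Ta , stays b Tb
    where
    stays : ∀ i → T i ≡ true → insert q i ≡ true
    stays i Ti with i ≟ q
    ... | yes ≡.refl = updateAt-updates q T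
    ... | no  i≢q  = ≡.trans (updateAt-minimal i q T i≢q) Ti

module _ {m} (T : Fin (suc m) → Bool) where

  isSingleton-fromℕ : IsSingleton T (fromℕ m) → IsEmpty (T ∘ inject₁)
  isSingleton-fromℕ (_ , unique) i with T (inject₁ i) in Ti
  ... | false = ≡.refl
  ... | true  = contradiction (unique (inject₁ i) Ti) (inject₁≢fromℕ i)

  isSingleton-inject₁ : ∀ {r} → IsSingleton T (inject₁ r) → IsSingleton (T ∘ inject₁) r × T (fromℕ m) ≡ false
  isSingleton-inject₁ {r} (Tr , unique) = (Tr , λ i Ti → inject₁-injective (unique (inject₁ i) Ti)) , last-false
    where
    last-false : T (fromℕ m) ≡ false
    last-false with T (fromℕ m) in Tl
    ... | false = ≡.refl
    ... | true  = contradiction (≡.sym (unique (fromℕ m) Tl)) (inject₁≢fromℕ r)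

  hasTwoElements-inject₁ : HasTwoElements T → T (fromℕ m) ≡ false → HasTwoElements (T ∘ inject₁)
  hasTwoElements-inject₁ (a , b , a≢b , Ta , Tb) Tl with lastView a | lastView b
  ... | init-view i | init-view k = i , k , a≢b ∘ ≡.cong inject₁ , Ta , Tb
  ... | last-view   | _           = contradiction (≡.trans (≡.sym Ta) Tl) λ ()
  ... | init-view _ | last-view   = contradiction (≡.trans (≡.sym Tb) Tl) λ ()

  hasTwoElements⇒init-nonempty : HasTwoElements T → ∃ λ r → T (inject₁ r) ≡ true
  hasTwoElements⇒init-nonempty (a , b , a≢b , Ta , Tb) with lastView a | lastView b
  ... | init-view i | _           = i , Ta
  ... | last-view   | init-view k = k , Tb
  ... | last-view   | last-view   = contradiction ≡.refl a≢b

_≗?_ : ∀ {m n} (f g : Fin m → Fin n) → Dec (f ≗ g)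
f ≗? g = all? λ i → f i ≟ g i

perms : ∀ m → List (Fin m → Fin m)
perms m = filter isPermutation? (allFuns m m)

extensions : ∀ m → List (Fin (suc m) → Fin (suc m))
extensions m = map extend (perms m) ++ concatMap (λ q → map (insertAfter q) (perms m)) (allFin m)

isPermutation-resp-≗ : ∀ {n} {σ σ′ : Fin n → Fin n} → σ ≗ σ′ → IsPermutation σ → IsPermutation σ′
isPermutation-resp-≗ e σ-inj i k σ′i≡σ′k = σ-inj i k (≡.trans (e i) (≡.trans σ′i≡σ′k (≡.sym (e k))))

module _ {c ℓ} (R : CommutativeRing c ℓ) where

  open CommutativeRing R hiding (zero)
  open import Algebra.Properties.Semiring.Sum semiring
  open import Algebra.Properties.CommutativeMonoid.Sum *-commutativeMonoid
    using () renaming (sum to prod; sum-cong-≋ to prod-cong; sum-init-last to prod-init-last; sum-remove to prod-remove)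
  open import Algebra.Properties.Ring ring using (-‿distribˡ-*; -‿distribʳ-*; -0#≈0#; -‿+-comm; -1*x≈-x)
  open import Algebra.Properties.CommutativeSemigroup *-commutativeSemigroup using (x∙yz≈z∙xy; xy∙z≈zy∙x)
  open import Algebra.Properties.CommutativeSemigroup +-commutativeSemigroup using () renaming (interchange to +-interchange)
  open import Relation.Binary.Reasoning.Setoid setoid

  ∑ₗ : ∀ {a} {A : Set a} → List A → (A → Carrier) → Carrier
  ∑ₗ L f = sumR R (map f L)

  module _ {a} {A : Set a} where

    ∑ₗ-cong : ∀ (L : List A) {f g : A → Carrier} → (∀ x → f x ≈ g x) → ∑ₗ L f ≈ ∑ₗ L g
    ∑ₗ-cong []      e = refl
    ∑ₗ-cong (x ∷ L) e = +-cong (e x) (∑ₗ-cong L e)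

    ∑ₗ-zero : ∀ (L : List A) {f : A → Carrier} → (∀ x → f x ≈ 0#) → ∑ₗ L f ≈ 0#
    ∑ₗ-zero []      e = refl
    ∑ₗ-zero (x ∷ L) e = trans (+-cong (e x) (∑ₗ-zero L e)) (+-identityˡ 0#)

    ∑ₗ-++ : ∀ (L L′ : List A) (f : A → Carrier) → ∑ₗ (L ++ L′) f ≈ ∑ₗ L f + ∑ₗ L′ f
    ∑ₗ-++ []      L′ f = sym (+-identityˡ _)
    ∑ₗ-++ (x ∷ L) L′ f = trans (+-congˡ (∑ₗ-++ L L′ f)) (sym (+-assoc _ _ _))

    ∑ₗ-+ : ∀ (L : List A) (f g : A → Carrier) → ∑ₗ L (λ x → f x + g x) ≈ ∑ₗ L f + ∑ₗ L g
    ∑ₗ-+ []      f g = sym (+-identityˡ 0#)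
    ∑ₗ-+ (x ∷ L) f g = trans (+-congˡ (∑ₗ-+ L f g)) (+-interchange (f x) (g x) _ _)

    ∑ₗ-*ˡ : ∀ (L : List A) k (f : A → Carrier) → ∑ₗ L (λ x → k * f x) ≈ k * ∑ₗ L f
    ∑ₗ-*ˡ []      k f = sym (zeroʳ k)
    ∑ₗ-*ˡ (x ∷ L) k f = trans (+-congˡ (∑ₗ-*ˡ L k f)) (sym (distribˡ k _ _))

    module _ {p} {P : Pred A p} (P? : Decidable P) where

      ∑ₗ-filter : ∀ (L : List A) (f : A → Carrier) → ∑ₗ (filter P? L) f ≈ ∑ₗ L (λ x → if does (P? x) then f x else 0#)
      ∑ₗ-filter []      f = refl
      ∑ₗ-filter (x ∷ L) f with does (P? x)
      ... | true  = +-congˡ (∑ₗ-filter L f)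
      ... | false = trans (∑ₗ-filter L f) (sym (+-identityˡ _))

      ∑ₗ-filter-cong : ∀ (L : List A) {f g : A → Carrier} → (∀ x → P x → f x ≈ g x) → ∑ₗ (filter P? L) f ≈ ∑ₗ (filter P? L) g
      ∑ₗ-filter-cong []      e = refl
      ∑ₗ-filter-cong (x ∷ L) e with P? x
      ... | yes Px = +-cong (e x Px) (∑ₗ-filter-cong L e)
      ... | no  _  = ∑ₗ-filter-cong L e

      prodR-filter : ∀ (L : List A) (f : A → Carrier) →
        prodR R (map f (filter P? L)) ≈ prodR R (map (λ x → if does (P? x) then f x else 1#) L)
      prodR-filter []      f = refl
      prodR-filter (x ∷ L) f with does (P? x)
      ... | true  = *-congˡ (prodR-filter L f)
      ... | false = trans (prodR-filter L f) (sym (*-identityˡ _))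

  module _ {a b} {A : Set a} {B : Set b} where

    ∑ₗ-map : ∀ (h : A → B) (L : List A) (f : B → Carrier) → ∑ₗ (map h L) f ≡ ∑ₗ L (f ∘ h)
    ∑ₗ-map h L f = ≡.cong (sumR R) (≡.sym (map-∘ L))

    ∑ₗ-concatMap : ∀ (g : A → List B) (L : List A) (f : B → Carrier) → ∑ₗ (concatMap g L) f ≈ ∑ₗ L (λ x → ∑ₗ (g x) f)
    ∑ₗ-concatMap g []      f = refl
    ∑ₗ-concatMap g (x ∷ L) f = trans (∑ₗ-++ (g x) (concatMap g L) f) (+-congˡ (∑ₗ-concatMap g L f))

    ∑ₗ-comm : ∀ (L : List A) (L′ : List B) (f : A → B → Carrier) →
      ∑ₗ L (λ x → ∑ₗ L′ (f x)) ≈ ∑ₗ L′ (λ y → ∑ₗ L (λ x → f x y))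
    ∑ₗ-comm []      L′ f = sym (∑ₗ-zero L′ (λ _ → refl))
    ∑ₗ-comm (x ∷ L) L′ f = trans (+-congˡ (∑ₗ-comm L L′ f)) (sym (∑ₗ-+ L′ (f x) _))

  ∑ₗ-allFin : ∀ n (f : Fin n → Carrier) → ∑ₗ (allFin n) f ≡ sum f
  ∑ₗ-allFin n f = ≡.trans (≡.cong (sumR R) (map-tabulate id f)) (sumR-tabulate n)
    where
    sumR-tabulate : ∀ n {f : Fin n → Carrier} → sumR R (tabulate f) ≡ sum f
    sumR-tabulate zero    = ≡.refl
    sumR-tabulate (suc n) = ≡.cong (_ +_) (sumR-tabulate n)

  prodR-allFin : ∀ n (f : Fin n → Carrier) → prodR R (map f (allFin n)) ≡ prod f
  prodR-allFin n f = ≡.trans (≡.cong (prodR R) (map-tabulate id f)) (prodR-tabulate n)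
    where
    prodR-tabulate : ∀ n {f : Fin n → Carrier} → prodR R (tabulate f) ≡ prod f
    prodR-tabulate zero    = ≡.refl
    prodR-tabulate (suc n) = ≡.cong (_ *_) (prodR-tabulate n)

  sum-single : ∀ {n} (t : Vector Carrier n) k → (∀ j → j ≢ k → t j ≈ 0#) → sum t ≈ t k
  sum-single {suc n} t k others = begin
    sum t                      ≈⟨ sum-remove t ⟩
    t k + sum (removeAt t k)   ≈⟨ +-congˡ (sum-cong-≋ (λ j → others (punchIn k j) (punchInᵢ≢i k j))) ⟩
    t k + sum (replicate n 0#) ≈⟨ +-congˡ (sum-replicate-zero n) ⟩
    t k + 0#                   ≈⟨ +-identityʳ (t k) ⟩
    t k                        ∎

  prod-zero : ∀ {n} (t : Vector Carrier n) k → t k ≈ 0# → prod t ≈ 0#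
  prod-zero {suc n} t k tk≈0 = trans (prod-remove t) (trans (*-congʳ tk≈0) (zeroˡ _))

  prod-exchange : ∀ {n} (f g : Vector Carrier n) k → (∀ j → j ≢ k → f j ≈ g j) → prod f * g k ≈ prod g * f k
  prod-exchange {suc n} f g k f≈g = begin
    prod f * g k                              ≈⟨ *-congʳ (prod-remove f) ⟩
    (f k * prod (removeAt f k)) * g k         ≈⟨ *-congʳ (*-congˡ (prod-cong λ j → f≈g (punchIn k j) (punchInᵢ≢i k j))) ⟩
    (f k * prod (removeAt g k)) * g k         ≈⟨ xy∙z≈zy∙x (f k) _ (g k) ⟩
    (g k * prod (removeAt g k)) * f k         ≈⟨ *-congʳ (prod-remove g) ⟨
    prod g * f k                              ∎

  ∑-neg : ∀ {n} (f : Vector Carrier n) → ∑[ i < n ] (- f i) ≈ - sum f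
  ∑-neg {zero}  f = sym -0#≈0#
  ∑-neg {suc n} f = trans (+-congˡ (∑-neg (f ∘ suc))) (-‿+-comm _ _)

  -- Opaque, so that unification sees δ f g x instead of the unfolded decision procedure.
  opaque
    δ : ∀ {m n} → (Fin m → Fin n) → (Fin m → Fin n) → Carrier → Carrier
    δ f g x = if does (f ≗? g) then x else 0#

    δ-≗ : ∀ {m n} {f g : Fin m → Fin n} {x} → f ≗ g → δ f g x ≡ x
    δ-≗ {f = f} {g} e rewrite dec-true (f ≗? g) e = ≡.refl

    δ-≉ : ∀ {m n} {f g : Fin m → Fin n} {x} → ¬ f ≗ g → δ f g x ≡ 0#
    δ-≉ {f = f} {g} ne rewrite dec-false (f ≗? g) ne = ≡.refl

    δ-⇔ : ∀ {m n m′ n′} {f g : Fin m → Fin n} {f′ g′ : Fin m′ → Fin n′} {x} → f ≗ g ⇔ f′ ≗ g′ → δ f g x ≡ δ f′ g′ x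
    δ-⇔ {f = f} {g} {f′} {g′} {x} iff = ≡.cong (if_then x else 0#) (does-⇔ iff (f ≗? g) (f′ ≗? g′))

    δ-if : ∀ {m n} {f g : Fin m → Fin n} {x} c → (if c then δ f g x else 0#) ≡ δ f g (if c then x else 0#)
    δ-if {f = f} {g} c = if-swap-then c (does (f ≗? g))

  δ-sym : ∀ {m n} {f g : Fin m → Fin n} {x} → δ f g x ≡ δ g f x
  δ-sym = δ-⇔ (mk⇔ (λ e → ≡.sym ∘ e) (λ e → ≡.sym ∘ e))

  Respects≗ : ∀ {m n} → ((Fin m → Fin n) → Carrier) → Set ℓ
  Respects≗ F = ∀ {f g} → f ≗ g → F f ≈ F g

  ∑ₗ-allFuns-δ : ∀ m n (g : Fin m → Fin n) (F : (Fin m → Fin n) → Carrier) → Respects≗ F →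
    ∑ₗ (allFuns m n) (λ b → δ g b (F b)) ≈ F g
  ∑ₗ-allFuns-δ zero    n g F F-resp = trans (+-identityʳ _) (empty _)
    where
    empty : ∀ b → δ g b (F b) ≈ F g
    empty b = trans (reflexive (δ-≗ {f = g} {b} λ ())) (F-resp λ ())
  ∑ₗ-allFuns-δ (suc m) n g F F-resp = step _ (λ _ _ → ≡.refl) (λ _ _ _ → ≡.refl)
    where
    -- allFuns builds its functions with a helper local to Defs; step abstracts over it.
    step : (h : Fin n → (Fin m → Fin n) → Fin (suc m) → Fin n) → (∀ a f → h a f zero ≡ a) → (∀ a f → h a f ∘ suc ≗ f) →
      ∑ₗ (concatMap (λ a → map (h a) (allFuns m n)) (allFin n)) (λ b → δ g b (F b)) ≈ F g
    step h h-zero h-suc = begin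
      ∑ₗ (concatMap (λ a → map (h a) (allFuns m n)) (allFin n)) (λ b → δ g b (F b))
        ≈⟨ ∑ₗ-concatMap _ (allFin n) _ ⟩
      ∑ₗ (allFin n) (λ a → ∑ₗ (map (h a) (allFuns m n)) (λ b → δ g b (F b)))
        ≈⟨ ∑ₗ-cong (allFin n) (λ a → reflexive (∑ₗ-map (h a) (allFuns m n) _)) ⟩
      ∑ₗ (allFin n) inner
        ≡⟨ ∑ₗ-allFin n inner ⟩
      sum inner
        ≈⟨ sum-single inner (g zero) inner-off ⟩
      inner (g zero)
        ≈⟨ ∑ₗ-cong (allFuns m n) (λ f → reflexive (δ-⇔ (tail-≗ f))) ⟩
      ∑ₗ (allFuns m n) (λ f → δ (g ∘ suc) f (F (h (g zero) f)))
        ≈⟨ ∑ₗ-allFuns-δ m n (g ∘ suc) (F ∘ h (g zero)) (λ e → F-resp (h-cong e)) ⟩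
      F (h (g zero) (g ∘ suc))
        ≈⟨ F-resp (λ { zero → h-zero _ _ ; (suc i) → h-suc _ _ i }) ⟩
      F g ∎
      where
      inner : Fin n → Carrier
      inner a = ∑ₗ (allFuns m n) (λ f → δ g (h a f) (F (h a f)))
      inner-off : ∀ a → a ≢ g zero → inner a ≈ 0#
      inner-off a a≢g₀ = ∑ₗ-zero (allFuns m n) λ f →
        reflexive (δ-≉ {f = g} {h a f} {F (h a f)} λ e → a≢g₀ (≡.trans (≡.sym (h-zero a f)) (≡.sym (e zero))))
      tail-≗ : ∀ f → g ≗ h (g zero) f ⇔ g ∘ suc ≗ f
      tail-≗ f = mk⇔ (λ e i → ≡.trans (e (suc i)) (h-suc _ f i))
                     (λ e → λ { zero → ≡.sym (h-zero _ f) ; (suc i) → ≡.trans (e i) (≡.sym (h-suc _ f i)) })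
      h-cong : ∀ {a f f′} → f ≗ f′ → h a f ≗ h a f′
      h-cong {a} {f} {f′} e zero    = ≡.trans (h-zero a f) (≡.sym (h-zero a f′))
      h-cong {a} {f} {f′} e (suc i) = ≡.trans (h-suc a f i) (≡.trans (e i) (≡.sym (h-suc a f′ i)))

  ∑ₗ-perms-δ : ∀ m (g : Fin m → Fin m) (F : (Fin m → Fin m) → Carrier) → Respects≗ F → IsPermutation g →
    ∑ₗ (perms m) (λ b → δ g b (F b)) ≈ F g
  ∑ₗ-perms-δ m g F F-resp g-inj = begin
    ∑ₗ (perms m) (λ b → δ g b (F b))
      ≈⟨ ∑ₗ-filter isPermutation? (allFuns m m) _ ⟩
    ∑ₗ (allFuns m m) (λ b → if does (isPermutation? b) then δ g b (F b) else 0#)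
      ≈⟨ ∑ₗ-cong (allFuns m m) (λ b → reflexive (δ-if (does (isPermutation? b)))) ⟩
    ∑ₗ (allFuns m m) (λ b → δ g b (F′ b))
      ≈⟨ ∑ₗ-allFuns-δ m m g F′ F′-resp ⟩
    F′ g
      ≡⟨ ≡.cong (if_then F g else 0#) (dec-true (isPermutation? g) g-inj) ⟩
    F g ∎
    where
    F′ : (Fin m → Fin m) → Carrier
    F′ b = if does (isPermutation? b) then F b else 0#
    F′-resp : Respects≗ F′
    F′-resp {f} {f′} e = trans (reflexive (≡.cong (if_then F f else 0#)
        (does-⇔ (mk⇔ (isPermutation-resp-≗ e) (isPermutation-resp-≗ (≡.sym ∘ e))) (isPermutation? f) (isPermutation? f′))))
      (ifF-cong (does (isPermutation? f′)))
      where
      ifF-cong : ∀ b → (if b then F f else 0#) ≈ (if b then F f′ else 0#)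
      ifF-cong true  = F-resp e
      ifF-cong false = refl

  ∑ₗ-extensions : ∀ m (G : (Fin (suc m) → Fin (suc m)) → Carrier) →
    ∑ₗ (extensions m) G ≈ ∑ₗ (perms m) (G ∘ extend) + ∑[ q < m ] ∑ₗ (perms m) (G ∘ insertAfter q)
  ∑ₗ-extensions m G = begin
    ∑ₗ (extensions m) G
      ≈⟨ ∑ₗ-++ (map extend (perms m)) _ G ⟩
    ∑ₗ (map extend (perms m)) G + ∑ₗ (concatMap (λ q → map (insertAfter q) (perms m)) (allFin m)) G
      ≈⟨ +-cong (reflexive (∑ₗ-map extend (perms m) G)) (∑ₗ-concatMap _ (allFin m) G) ⟩
    ∑ₗ (perms m) (G ∘ extend) + ∑ₗ (allFin m) (λ q → ∑ₗ (map (insertAfter q) (perms m)) G)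
      ≈⟨ +-congˡ (∑ₗ-cong (allFin m) (λ q → reflexive (∑ₗ-map (insertAfter q) (perms m) G))) ⟩
    ∑ₗ (perms m) (G ∘ extend) + ∑ₗ (allFin m) (λ q → ∑ₗ (perms m) (G ∘ insertAfter q))
      ≡⟨ ≡.cong (∑ₗ (perms m) (G ∘ extend) +_) (∑ₗ-allFin m _) ⟩
    ∑ₗ (perms m) (G ∘ extend) + ∑[ q < m ] ∑ₗ (perms m) (G ∘ insertAfter q) ∎

  ∑ₗ-extensions-cong : ∀ m {G H : (Fin (suc m) → Fin (suc m)) → Carrier} → (∀ σ → IsPermutation σ → G σ ≈ H σ) →
    ∑ₗ (extensions m) G ≈ ∑ₗ (extensions m) H
  ∑ₗ-extensions-cong m {G} {H} G≈H = begin
    ∑ₗ (extensions m) G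
      ≈⟨ ∑ₗ-extensions m G ⟩
    ∑ₗ (perms m) (G ∘ extend) + ∑[ q < m ] ∑ₗ (perms m) (G ∘ insertAfter q)
      ≈⟨ +-cong (∑ₗ-filter-cong isPermutation? (allFuns m m) (λ τ τ-inj → G≈H _ (extend-injective τ τ-inj)))
                (sum-cong-≋ λ q → ∑ₗ-filter-cong isPermutation? (allFuns m m) (λ τ τ-inj → G≈H _ (insertAfter-injective q τ τ-inj))) ⟩
    ∑ₗ (perms m) (H ∘ extend) + ∑[ q < m ] ∑ₗ (perms m) (H ∘ insertAfter q)
      ≈⟨ ∑ₗ-extensions m H ⟨
    ∑ₗ (extensions m) H ∎

  ∑ₗ-perms-δ-contract : ∀ m (σ : Fin (suc m) → Fin (suc m)) → IsPermutation σ →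
    (F : (Fin (suc m) → Fin (suc m)) → Carrier) → Respects≗ F →
    (φ : (Fin m → Fin m) → Fin (suc m) → Fin (suc m)) → (∀ {τ τ′} → τ ≗ τ′ → φ τ ≗ φ τ′) →
    (∀ τ → contract (φ τ) ≗ τ) → φ (contract σ) ≗ σ →
    ∑ₗ (perms m) (λ τ → δ σ (φ τ) (F (φ τ))) ≈ F σ
  ∑ₗ-perms-δ-contract m σ σ-inj F F-resp φ φ-cong contract-φ φ-contract = begin
    ∑ₗ (perms m) (λ τ → δ σ (φ τ) (F (φ τ)))
      ≈⟨ ∑ₗ-cong (perms m) (λ τ → reflexive (δ-⇔ (same τ))) ⟩
    ∑ₗ (perms m) (λ τ → δ (contract σ) τ (F (φ τ)))
      ≈⟨ ∑ₗ-perms-δ m (contract σ) (F ∘ φ) (F-resp ∘ φ-cong) (contract-injective σ σ-inj) ⟩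
    F (φ (contract σ))
      ≈⟨ F-resp φ-contract ⟩
    F σ ∎
    where
    same : ∀ τ → σ ≗ φ τ ⇔ contract σ ≗ τ
    same τ = mk⇔ (λ e i → ≡.trans (contract-cong e i) (contract-φ τ i))
                 (λ e k → ≡.trans (≡.sym (φ-contract k)) (φ-cong e k))

  ∑ₗ-extensions-δ : ∀ m (σ : Fin (suc m) → Fin (suc m)) → IsPermutation σ →
    (F : (Fin (suc m) → Fin (suc m)) → Carrier) → Respects≗ F →
    ∑ₗ (extensions m) (λ b → δ σ b (F b)) ≈ F σ
  ∑ₗ-extensions-δ m σ σ-inj F F-resp with σ (fromℕ m) ≟ fromℕ m
  ... | yes σ-last = begin
    ∑ₗ (extensions m) (λ b → δ σ b (F b))
      ≈⟨ ∑ₗ-extensions m _ ⟩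
    ∑ₗ (perms m) (λ τ → δ σ (extend τ) (F (extend τ))) + ∑[ q < m ] ∑ₗ (perms m) (λ τ → δ σ (insertAfter q τ) (F (insertAfter q τ)))
      ≈⟨ +-cong (∑ₗ-perms-δ-contract m σ σ-inj F F-resp extend extend-cong contract-extend (extend-contract σ σ-inj σ-last))
                (trans (sum-cong-≋ λ q → ∑ₗ-zero (perms m) λ τ → reflexive (δ-≉ λ e → inject₁≢fromℕ (τ q)
                          (≡.trans (≡.sym (insertAfter-fromℕ q τ)) (≡.trans (≡.sym (e (fromℕ m))) σ-last))))
                       (sum-replicate-zero m)) ⟩
    F σ + 0#
      ≈⟨ +-identityʳ _ ⟩
    F σ ∎
  ... | no σ-last≢last with injective⇒surjective σ σ-inj (fromℕ m)
  ...   | k , σk≡last with lastView k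
  ...     | last-view = contradiction σk≡last σ-last≢last
  ...     | init-view q₀ = begin
    ∑ₗ (extensions m) (λ b → δ σ b (F b))
      ≈⟨ ∑ₗ-extensions m _ ⟩
    ∑ₗ (perms m) (λ τ → δ σ (extend τ) (F (extend τ))) + ∑[ q < m ] ∑ₗ (perms m) (λ τ → δ σ (insertAfter q τ) (F (insertAfter q τ)))
      ≈⟨ +-cong (∑ₗ-zero (perms m) λ τ → reflexive (δ-≉ λ e → σ-last≢last (≡.trans (e (fromℕ m)) (extend-fromℕ τ))))
                (sum-single _ q₀ λ q q≢q₀ → ∑ₗ-zero (perms m) λ τ → reflexive (δ-≉ λ e → q≢q₀
                   (inject₁-injective (σ-inj _ _ (≡.trans (e (inject₁ q)) (≡.trans (insertAfter-at q τ) (≡.sym σk≡last))))))) ⟩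
    0# + ∑ₗ (perms m) (λ τ → δ σ (insertAfter q₀ τ) (F (insertAfter q₀ τ)))
      ≈⟨ +-identityˡ _ ⟩
    ∑ₗ (perms m) (λ τ → δ σ (insertAfter q₀ τ) (F (insertAfter q₀ τ)))
      ≈⟨ ∑ₗ-perms-δ-contract m σ σ-inj F F-resp (insertAfter q₀) (insertAfter-cong q₀) (contract-insertAfter q₀)
           (insertAfter-contract q₀ σ σ-inj σk≡last) ⟩
    F σ ∎

  -- Both perms (suc m) and extensions m list every permutation exactly once up to ≗, so summing
  -- δ σ b (F b) over both lists in either order gives the same result.
  ∑ₗ-perms-suc : ∀ m (F : (Fin (suc m) → Fin (suc m)) → Carrier) → Respects≗ F →
    ∑ₗ (perms (suc m)) F ≈ ∑ₗ (perms m) (F ∘ extend) + ∑[ q < m ] ∑ₗ (perms m) (F ∘ insertAfter q)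
  ∑ₗ-perms-suc m F F-resp = begin
    ∑ₗ (perms (suc m)) F
      ≈⟨ ∑ₗ-filter-cong isPermutation? (allFuns (suc m) (suc m)) (λ σ σ-inj → sym (∑ₗ-extensions-δ m σ σ-inj F F-resp)) ⟩
    ∑ₗ (perms (suc m)) (λ σ → ∑ₗ (extensions m) (λ b → δ σ b (F b)))
      ≈⟨ ∑ₗ-comm (perms (suc m)) (extensions m) _ ⟩
    ∑ₗ (extensions m) (λ b → ∑ₗ (perms (suc m)) (λ σ → δ σ b (F b)))
      ≈⟨ ∑ₗ-extensions-cong m (λ b b-inj → trans (∑ₗ-cong (perms (suc m)) (λ σ → reflexive δ-sym))
                                                   (∑ₗ-perms-δ (suc m) b (λ _ → F b) (λ _ → refl) b-inj)) ⟩
    ∑ₗ (extensions m) F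
      ≈⟨ ∑ₗ-extensions m F ⟩
    ∑ₗ (perms m) (F ∘ extend) + ∑[ q < m ] ∑ₗ (perms m) (F ∘ insertAfter q) ∎

  -- The cycle sum of a matrix

  -- (−1)^{cyc σ} = (−1)^m sgn σ, so cycleSum W = det(−W) and cycleSum-expand-last is its expansion
  -- along the last column.
  Matrix : ℕ → Set c
  Matrix m = Fin m → Fin m → Carrier

  cycleTerm : ∀ {m} → Matrix m → (Fin m → Fin m) → Carrier
  cycleTerm W σ = negOnePow R (cyc σ) * prod (λ i → W i (σ i))

  cycleSum : ∀ {m} → Matrix m → Carrier
  cycleSum {m} W = ∑ₗ (perms m) (cycleTerm W)

  dropLast : ∀ {m} → Matrix (suc m) → Matrix m
  dropLast W i k = W (inject₁ i) (inject₁ k)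

  lastRow : ∀ {m} → Matrix (suc m) → Fin m → Carrier
  lastRow {m} W k = W (fromℕ m) (inject₁ k)

  cycleTerm-resp-≗ : ∀ {m} (W : Matrix m) → Respects≗ (cycleTerm W)
  cycleTerm-resp-≗ W e = *-cong (reflexive (≡.cong (negOnePow R) (cyc-cong e))) (prod-cong (λ i → reflexive (≡.cong (W i) (e i))))

  cycleTerm-extend : ∀ {m} (W : Matrix (suc m)) τ → IsPermutation τ →
    cycleTerm W (extend τ) ≈ - W (fromℕ m) (fromℕ m) * cycleTerm (dropLast W) τ
  cycleTerm-extend {m} W τ τ-inj = begin
    negOnePow R (cyc (extend τ)) * prod (λ k → W k (extend τ k))
      ≈⟨ *-cong (reflexive (≡.cong (negOnePow R) (cyc-extend τ τ-inj))) (prod-init-last (λ k → W k (extend τ k))) ⟩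
    (- s) * (prod (λ i → W (inject₁ i) (extend τ (inject₁ i))) * W (fromℕ m) (extend τ (fromℕ m)))
      ≈⟨ *-congˡ (*-cong (prod-cong (λ i → reflexive (≡.cong (W (inject₁ i)) (extend-inject₁ τ i))))
                         (reflexive (≡.cong (W (fromℕ m)) (extend-fromℕ τ)))) ⟩
    (- s) * (p * w)
      ≈⟨ -‿distribˡ-* s (p * w) ⟨
    - (s * (p * w))
      ≈⟨ -‿cong (x∙yz≈z∙xy s p w) ⟩
    - (w * (s * p))
      ≈⟨ -‿distribˡ-* w (s * p) ⟩
    - w * (s * p) ∎
    where
    s p w : Carrier
    s = negOnePow R (cyc τ)
    p = prod (λ i → dropLast W i (τ i))
    w = W (fromℕ m) (fromℕ m)

  cycleTerm-insertAfter : ∀ {m} (W : Matrix (suc m)) q τ → IsPermutation τ →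
    cycleTerm W (insertAfter q τ) ≈ W (inject₁ q) (fromℕ m) * cycleTerm (updateAt (dropLast W) q (const (lastRow W))) τ
  cycleTerm-insertAfter {m} W q τ τ-inj = begin
    negOnePow R (cyc (insertAfter q τ)) * prod (λ k → W k (insertAfter q τ k))
      ≈⟨ *-cong (reflexive (≡.cong (negOnePow R) (cyc-insertAfter q τ τ-inj))) (prod-init-last (λ k → W k (insertAfter q τ k))) ⟩
    s * (prod f * W (fromℕ m) (insertAfter q τ (fromℕ m)))
      ≈⟨ *-congˡ (*-congˡ (reflexive (≡.trans (≡.cong (W (fromℕ m)) (insertAfter-fromℕ q τ))
                                               (≡.sym (≡.cong (λ r → r (τ q)) (updateAt-updates q (dropLast W))))))) ⟩
    s * (prod f * g q)
      ≈⟨ *-congˡ (prod-exchange f g q (λ i i≢q → reflexive (≡.trans (≡.cong (W (inject₁ i)) (insertAfter-inject₁ q τ i≢q))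
                                                                     (≡.sym (≡.cong (λ r → r (τ i)) (updateAt-minimal i q (dropLast W) i≢q)))))) ⟩
    s * (prod g * f q)
      ≈⟨ x∙yz≈z∙xy s (prod g) (f q) ⟩
    f q * (s * prod g)
      ≈⟨ *-congʳ (reflexive (≡.cong (W (inject₁ q)) (insertAfter-at q τ))) ⟩
    W (inject₁ q) (fromℕ m) * cycleTerm U τ ∎
    where
    U : Matrix m
    U = updateAt (dropLast W) q (const (lastRow W))
    s : Carrier
    s = negOnePow R (cyc τ)
    f g : Fin m → Carrier
    f i = W (inject₁ i) (insertAfter q τ (inject₁ i))
    g i = U i (τ i)

  cycleSum-expand-last : ∀ m (W : Matrix (suc m)) →
    cycleSum W ≈ - W (fromℕ m) (fromℕ m) * cycleSum (dropLast W)
               + ∑[ q < m ] (W (inject₁ q) (fromℕ m) * cycleSum (updateAt (dropLast W) q (const (lastRow W))))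
  cycleSum-expand-last m W = begin
    cycleSum W
      ≈⟨ ∑ₗ-perms-suc m (cycleTerm W) (cycleTerm-resp-≗ W) ⟩
    ∑ₗ (perms m) (cycleTerm W ∘ extend) + ∑[ q < m ] ∑ₗ (perms m) (cycleTerm W ∘ insertAfter q)
      ≈⟨ +-cong (∑ₗ-filter-cong isPermutation? (allFuns m m) (cycleTerm-extend W))
                (sum-cong-≋ {m} λ q → ∑ₗ-filter-cong isPermutation? (allFuns m m) (cycleTerm-insertAfter W q)) ⟩
    ∑ₗ (perms m) (λ τ → - W (fromℕ m) (fromℕ m) * cycleTerm (dropLast W) τ)
      + ∑[ q < m ] ∑ₗ (perms m) (λ τ → W (inject₁ q) (fromℕ m) * cycleTerm (updateAt (dropLast W) q (const (lastRow W))) τ)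
      ≈⟨ +-cong (∑ₗ-*ˡ (perms m) _ _) (sum-cong-≋ {m} λ q → ∑ₗ-*ˡ (perms m) _ _) ⟩
    - W (fromℕ m) (fromℕ m) * cycleSum (dropLast W)
      + ∑[ q < m ] (W (inject₁ q) (fromℕ m) * cycleSum (updateAt (dropLast W) q (const (lastRow W)))) ∎

  cycleSum-cong : ∀ {m} {W W′ : Matrix m} → (∀ i k → W i k ≈ W′ i k) → cycleSum W ≈ cycleSum W′
  cycleSum-cong {m} W≈W′ = ∑ₗ-cong (perms m) λ σ → *-congˡ (prod-cong λ i → W≈W′ i (σ i))

  cycleSum-zero-row : ∀ {m} (W : Matrix m) r → (∀ k → W r k ≈ 0#) → cycleSum W ≈ 0#
  cycleSum-zero-row {m} W r row≈0 = ∑ₗ-zero (perms m) λ σ →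
    trans (*-congˡ (prod-zero (λ i → W i (σ i)) r (row≈0 (σ r)))) (zeroʳ _)

  cycleSum-empty : (W : Matrix 0) → cycleSum W ≈ 1#
  cycleSum-empty W = trans (+-identityʳ _) (*-identityʳ 1#)

  -- Excedance matrices with rows of ones

  -- ∏ᵢ excedanceMatrix x i (σ i) is ∏_{i ∈ EXCi σ} x i if σ has no fixed point, and 0 otherwise.
  excedanceMatrix : ∀ {m} → (Fin m → Carrier) → Matrix m
  excedanceMatrix x i k with <-cmp i k
  ... | tri< _ _ _ = x i
  ... | tri≈ _ _ _ = 0#
  ... | tri> _ _ _ = 1#

  module _ {m} (x : Fin m → Carrier) where

    excedanceMatrix-< : ∀ {i k} → i Fin.< k → excedanceMatrix x i k ≡ x i
    excedanceMatrix-< {i} {k} i<k with <-cmp i k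
    ... | tri< _ _ _    = ≡.refl
    ... | tri≈ i≮k _ _  = contradiction i<k i≮k
    ... | tri> i≮k _ _  = contradiction i<k i≮k

    excedanceMatrix-diag : ∀ i → excedanceMatrix x i i ≡ 0#
    excedanceMatrix-diag i with <-cmp i i
    ... | tri< _ i≢i _ = contradiction ≡.refl i≢i
    ... | tri≈ _ _ _   = ≡.refl
    ... | tri> _ i≢i _ = contradiction ≡.refl i≢i

    excedanceMatrix-> : ∀ {i k} → k Fin.< i → excedanceMatrix x i k ≡ 1#
    excedanceMatrix-> {i} {k} k<i with <-cmp i k
    ... | tri< _ _ k≮i = contradiction k<i k≮i
    ... | tri≈ _ _ k≮i = contradiction k<i k≮i
    ... | tri> _ _ _   = ≡.refl

  excedanceMatrix-inject₁ : ∀ {m} (x : Fin (suc m) → Carrier) i k →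
    excedanceMatrix x (inject₁ i) (inject₁ k) ≡ excedanceMatrix (x ∘ inject₁) i k
  excedanceMatrix-inject₁ x i k with <-cmp i k
  ... | tri< i<k _ _    = excedanceMatrix-< x (inject₁-mono-< i<k)
  ... | tri≈ _ ≡.refl _ = excedanceMatrix-diag x (inject₁ i)
  ... | tri> _ _ k<i    = excedanceMatrix-> x (inject₁-mono-< k<i)

  -- Expanding along the last column replaces a row by the last row, which is all ones: excedance
  -- matrices are not closed under the recursion, but excedance matrices with some rows of ones are.
  withOnesRows : ∀ {m} → (Fin m → Bool) → Matrix m → Matrix m
  withOnesRows T W i k = if T i then 1# else W i k

  onesRowsSum : ∀ {m} → (Fin m → Bool) → (Fin m → Carrier) → Carrier
  onesRowsSum T x = cycleSum (withOnesRows T (excedanceMatrix x))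

  insertOnesRow : ∀ {m} (W : Matrix (suc m)) (T : Fin m → Bool) (V : Matrix m) q → (∀ k → lastRow W k ≡ 1#) →
    (∀ i k → i ≢ q → dropLast W i k ≡ withOnesRows T V i k) →
    ∀ i k → updateAt (dropLast W) q (const (lastRow W)) i k ≡ withOnesRows (updateAt T q (const true)) V i k
  insertOnesRow W T V q ones agree i k with i ≟ q
  ... | yes ≡.refl = ≡.trans (≡.cong (λ r → r k) (updateAt-updates q (dropLast W)))
                       (≡.trans (ones k) (≡.cong (if_then 1# else V q k) (≡.sym (updateAt-updates q T))))
  ... | no i≢q = ≡.trans (≡.cong (λ r → r k) (updateAt-minimal i q (dropLast W) i≢q))
                   (≡.trans (agree i k i≢q) (≡.cong (if_then 1# else V i k) (≡.sym (updateAt-minimal i q T i≢q))))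

  onesRowsSum-expand-last : ∀ m (T : Fin (suc m) → Bool) (x : Fin (suc m) → Carrier) →
    onesRowsSum T x ≈ - (if T (fromℕ m) then 1# else 0#) * onesRowsSum (T ∘ inject₁) (x ∘ inject₁)
                    + ∑[ q < m ] ((if T (inject₁ q) then 1# else x (inject₁ q))
                                  * onesRowsSum (updateAt (T ∘ inject₁) q (const true)) (x ∘ inject₁))
  onesRowsSum-expand-last m T x = trans (cycleSum-expand-last m W)
    (+-cong (*-cong (-‿cong (reflexive corner)) (cycleSum-cong λ i k → reflexive (minor i k)))
            (sum-cong-≋ {m} λ q → *-cong (reflexive (column q))
              (cycleSum-cong λ i k → reflexive (insertOnesRow W (T ∘ inject₁) (excedanceMatrix (x ∘ inject₁)) q lastRow-ones
                                                  (λ i k _ → minor i k) i k))))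
    where
    W : Matrix (suc m)
    W = withOnesRows T (excedanceMatrix x)
    minor : ∀ i k → dropLast W i k ≡ withOnesRows (T ∘ inject₁) (excedanceMatrix (x ∘ inject₁)) i k
    minor i k = ≡.cong (if T (inject₁ i) then 1# else_) (excedanceMatrix-inject₁ x i k)
    corner : W (fromℕ m) (fromℕ m) ≡ (if T (fromℕ m) then 1# else 0#)
    corner = ≡.cong (if T (fromℕ m) then 1# else_) (excedanceMatrix-diag x (fromℕ m))
    column : ∀ q → W (inject₁ q) (fromℕ m) ≡ (if T (inject₁ q) then 1# else x (inject₁ q))
    column q = ≡.cong (if T (inject₁ q) then 1# else_) (excedanceMatrix-< x (inject₁<fromℕ q))
    lastRow-ones : ∀ k → lastRow W k ≡ 1#
    lastRow-ones k with T (fromℕ m)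
    ... | true  = ≡.refl
    ... | false = excedanceMatrix-> x (inject₁<fromℕ k)

  prefixProd-prod : ∀ m k (x : Fin m → Carrier) →
    prefixProd R m k x ≈ prod (λ i → if does (suc (toℕ i) ℕ.≤? k) then x i else 1#)
  prefixProd-prod m k x = trans (prodR-filter (λ i → suc (toℕ i) ℕ.≤? k) (allFin m) x) (reflexive (prodR-allFin m _))

  prefixProd-suc : ∀ m (x : Fin m → Carrier) q → prefixProd R m (suc (toℕ q)) x ≈ prefixProd R m (toℕ q) x * x q
  prefixProd-suc m x q = begin
    prefixProd R m (suc (toℕ q)) x ≈⟨ prefixProd-prod m _ x ⟩
    prod f                         ≈⟨ *-identityʳ (prod f) ⟨
    prod f * 1#                    ≡⟨ ≡.cong (λ b → prod f * (if b then x q else 1#)) (dec-false (suc (toℕ q) ℕ.≤? toℕ q) (ℕ.n≮n _)) ⟨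
    prod f * g q                   ≈⟨ prod-exchange f g q f≈g ⟩
    prod g * f q                   ≡⟨ ≡.cong (λ b → prod g * (if b then x q else 1#)) (dec-true (suc (toℕ q) ℕ.≤? suc (toℕ q)) ℕ.≤-refl) ⟩
    prod g * x q                   ≈⟨ *-congʳ (prefixProd-prod m _ x) ⟨
    prefixProd R m (toℕ q) x * x q ∎
    where
    f g : Fin m → Carrier
    f i = if does (suc (toℕ i) ℕ.≤? suc (toℕ q)) then x i else 1#
    g i = if does (suc (toℕ i) ℕ.≤? toℕ q) then x i else 1#
    f≈g : ∀ i → i ≢ q → f i ≈ g i
    f≈g i i≢q = reflexive (≡.cong (if_then x i else 1#) (does-⇔ below (suc (toℕ i) ℕ.≤? suc (toℕ q)) (suc (toℕ i) ℕ.≤? toℕ q)))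
      where
      below : suc (toℕ i) ℕ.≤ suc (toℕ q) ⇔ suc (toℕ i) ℕ.≤ toℕ q
      below = mk⇔ (λ le → ℕ.≤∧≢⇒< (ℕ.≤-pred le) (i≢q ∘ toℕ-injective)) ℕ.m≤n⇒m≤1+n

  prefixProd-init : ∀ m k (x : Fin (suc m) → Carrier) → k ℕ.≤ m → prefixProd R (suc m) k x ≈ prefixProd R m k (x ∘ inject₁)
  prefixProd-init m k x k≤m = begin
    prefixProd R (suc m) k x
      ≈⟨ prefixProd-prod (suc m) k x ⟩
    prod f
      ≈⟨ prod-init-last f ⟩
    prod (f ∘ inject₁) * f (fromℕ m)
      ≈⟨ *-cong (prod-cong λ i → reflexive (≡.cong (λ t → if does (suc t ℕ.≤? k) then x (inject₁ i) else 1#) (toℕ-inject₁ i)))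
                (reflexive (≡.cong (if_then x (fromℕ m) else 1#) (dec-false (suc (toℕ (fromℕ m)) ℕ.≤? k) last-excluded))) ⟩
    prod (λ i → if does (suc (toℕ i) ℕ.≤? k) then x (inject₁ i) else 1#) * 1#
      ≈⟨ *-identityʳ _ ⟩
    prod (λ i → if does (suc (toℕ i) ℕ.≤? k) then x (inject₁ i) else 1#)
      ≈⟨ prefixProd-prod m k (x ∘ inject₁) ⟨
    prefixProd R m k (x ∘ inject₁) ∎
    where
    f : Fin (suc m) → Carrier
    f i = if does (suc (toℕ i) ℕ.≤? k) then x i else 1#
    last-excluded : ¬ suc (toℕ (fromℕ m)) ℕ.≤ k
    last-excluded le = ℕ.<⇒≱ (ℕ.≤-trans le k≤m) (ℕ.≤-reflexive (≡.sym (toℕ-fromℕ m)))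

  derangementValue : ∀ {m} → (Fin m → Carrier) → Carrier
  derangementValue {m} x = prefixProd R m m x - ∑[ q < m ] prefixProd R m (suc (toℕ q)) x

  derangementValue-suc : ∀ m (x : Fin (suc m) → Carrier) →
    derangementValue x ≈ - ∑[ q < m ] prefixProd R m (suc (toℕ q)) (x ∘ inject₁)
  derangementValue-suc m x = begin
    P - ∑[ q < suc m ] prefixProd R (suc m) (suc (toℕ q)) x
      ≈⟨ +-congˡ (-‿cong (sum-init-last (λ q → prefixProd R (suc m) (suc (toℕ q)) x))) ⟩
    P - (∑[ q < m ] prefixProd R (suc m) (suc (toℕ (inject₁ q))) x + prefixProd R (suc m) (suc (toℕ (fromℕ m))) x)
      ≡⟨ ≡.cong₂ (λ s t → P - (s + prefixProd R (suc m) (suc t) x))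
                 (sum-cong-≗ {m} λ q → ≡.cong (λ t → prefixProd R (suc m) (suc t) x) (toℕ-inject₁ q)) (toℕ-fromℕ m) ⟩
    P - (∑[ q < m ] prefixProd R (suc m) (suc (toℕ q)) x + P)
      ≈⟨ +-congˡ (-‿cong (+-congʳ (sum-cong-≋ {m} λ q → prefixProd-init m (suc (toℕ q)) x (toℕ<n q)))) ⟩
    P - (S + P)
      ≈⟨ +-congˡ (-‿+-comm S P) ⟨
    P + (- S + - P)
      ≈⟨ +-congˡ (+-comm (- S) (- P)) ⟩
    P + (- P + - S)
      ≈⟨ +-assoc P (- P) (- S) ⟨
    (P - P) + - S
      ≈⟨ +-congʳ (-‿inverseʳ P) ⟩
    0# + - S
      ≈⟨ +-identityˡ (- S) ⟩
    - S ∎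
    where
    P S : Carrier
    P = prefixProd R (suc m) (suc m) x
    S = ∑[ q < m ] prefixProd R m (suc (toℕ q)) (x ∘ inject₁)

  record OnesRowsValues (m : ℕ) : Set (c ⊔ ℓ) where
    field
      empty     : ∀ (x : Fin m → Carrier) {T} → IsEmpty T → onesRowsSum T x ≈ derangementValue x
      singleton : ∀ (x : Fin m → Carrier) {T r} → IsSingleton T r → onesRowsSum T x ≈ - prefixProd R m (toℕ r) x
      two       : ∀ (x : Fin m → Carrier) {T} → HasTwoElements T → onesRowsSum T x ≈ 0#

  onesRowsValues-zero : OnesRowsValues 0
  onesRowsValues-zero = record
    { empty     = λ x {T} _ → trans (cycleSum-empty (withOnesRows T (excedanceMatrix x))) (sym (trans (+-congˡ -0#≈0#) (+-identityʳ 1#)))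
    ; singleton = λ { _ {r = ()} _ }
    ; two       = λ { _ (() , _) }
    }

  module _ m (IH : OnesRowsValues m) (x : Fin (suc m) → Carrier) where
    open OnesRowsValues IH

    private
      x′ : Fin m → Carrier
      x′ = x ∘ inject₁

      rest : (Fin m → Bool) → Carrier
      rest T′ = ∑[ q < m ] ((if T′ q then 1# else x′ q) * onesRowsSum (updateAt T′ q (const true)) x′)

    rest-empty : ∀ {T′} → IsEmpty T′ → rest T′ ≈ - ∑[ q < m ] prefixProd R m (suc (toℕ q)) x′
    rest-empty {T′} ∅ = trans (sum-cong-≋ {m} term) (∑-neg {m} (λ q → prefixProd R m (suc (toℕ q)) x′))
      where
      term : ∀ q → (if T′ q then 1# else x′ q) * onesRowsSum (updateAt T′ q (const true)) x′ ≈ - prefixProd R m (suc (toℕ q)) x′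
      term q = begin
        (if T′ q then 1# else x′ q) * onesRowsSum (updateAt T′ q (const true)) x′
          ≈⟨ *-cong (reflexive (≡.cong (if_then 1# else x′ q) (∅ q))) (singleton x′ (insert-isEmpty T′ ∅ q)) ⟩
        x′ q * - prefixProd R m (toℕ q) x′
          ≈⟨ -‿distribʳ-* (x′ q) _ ⟨
        - (x′ q * prefixProd R m (toℕ q) x′)
          ≈⟨ -‿cong (trans (*-comm _ _) (sym (prefixProd-suc m x′ q))) ⟩
        - prefixProd R m (suc (toℕ q)) x′ ∎

    rest-singleton : ∀ {T′ r} → IsSingleton T′ r → rest T′ ≈ - prefixProd R m (toℕ r) x′
    rest-singleton {T′} {r} T′-single = trans (sum-single _ r other) (begin
      (if T′ r then 1# else x′ r) * onesRowsSum (updateAt T′ r (const true)) x′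
        ≈⟨ *-cong (reflexive (≡.cong (if_then 1# else x′ r) (proj₁ T′-single))) (singleton x′ (insert-isSingleton T′ T′-single)) ⟩
      1# * - prefixProd R m (toℕ r) x′
        ≈⟨ *-identityˡ _ ⟩
      - prefixProd R m (toℕ r) x′ ∎)
      where
      other : ∀ q → q ≢ r → (if T′ q then 1# else x′ q) * onesRowsSum (updateAt T′ q (const true)) x′ ≈ 0#
      other q q≢r = trans (*-congˡ (two x′ (insert-isSingleton-other T′ T′-single q≢r))) (zeroʳ _)

    rest-two : ∀ {T′} → HasTwoElements T′ → rest T′ ≈ 0#
    rest-two {T′} T′-two = trans (sum-cong-≋ {m} λ q → trans (*-congˡ (two x′ (insert-hasTwoElements T′ T′-two q))) (zeroʳ _))
                                 (sum-replicate-zero m)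

    private
      expand : ∀ T → onesRowsSum T x ≈ - (if T (fromℕ m) then 1# else 0#) * onesRowsSum (T ∘ inject₁) x′ + rest (T ∘ inject₁)
      expand T = onesRowsSum-expand-last m T x

      expand-false : ∀ {T} → T (fromℕ m) ≡ false → onesRowsSum T x ≈ rest (T ∘ inject₁)
      expand-false {T} Tl = begin
        onesRowsSum T x
          ≈⟨ expand T ⟩
        - (if T (fromℕ m) then 1# else 0#) * onesRowsSum (T ∘ inject₁) x′ + rest (T ∘ inject₁)
          ≡⟨ ≡.cong (λ b → - (if b then 1# else 0#) * onesRowsSum (T ∘ inject₁) x′ + rest (T ∘ inject₁)) Tl ⟩
        - 0# * onesRowsSum (T ∘ inject₁) x′ + rest (T ∘ inject₁)
          ≈⟨ +-congʳ (trans (*-congʳ -0#≈0#) (zeroˡ _)) ⟩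
        0# + rest (T ∘ inject₁)
          ≈⟨ +-identityˡ _ ⟩
        rest (T ∘ inject₁) ∎

      expand-true : ∀ {T} → T (fromℕ m) ≡ true → onesRowsSum T x ≈ - onesRowsSum (T ∘ inject₁) x′ + rest (T ∘ inject₁)
      expand-true {T} Tl = begin
        onesRowsSum T x
          ≈⟨ expand T ⟩
        - (if T (fromℕ m) then 1# else 0#) * onesRowsSum (T ∘ inject₁) x′ + rest (T ∘ inject₁)
          ≡⟨ ≡.cong (λ b → - (if b then 1# else 0#) * onesRowsSum (T ∘ inject₁) x′ + rest (T ∘ inject₁)) Tl ⟩
        - 1# * onesRowsSum (T ∘ inject₁) x′ + rest (T ∘ inject₁)
          ≈⟨ +-congʳ (-1*x≈-x _) ⟩
        - onesRowsSum (T ∘ inject₁) x′ + rest (T ∘ inject₁) ∎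

    onesRowsSum-empty : ∀ {T} → IsEmpty T → onesRowsSum T x ≈ derangementValue x
    onesRowsSum-empty {T} ∅ = begin
      onesRowsSum T x                              ≈⟨ expand-false {T} (∅ (fromℕ m)) ⟩
      rest (T ∘ inject₁)                           ≈⟨ rest-empty (∅ ∘ inject₁) ⟩
      - ∑[ q < m ] prefixProd R m (suc (toℕ q)) x′ ≈⟨ derangementValue-suc m x ⟨
      derangementValue x                           ∎

    onesRowsSum-singleton : ∀ {T r} → IsSingleton T r → onesRowsSum T x ≈ - prefixProd R (suc m) (toℕ r) x
    onesRowsSum-singleton {T} {r} T-single with lastView r
    ... | last-view = begin
      onesRowsSum T x
        ≈⟨ expand-true {T} (proj₁ T-single) ⟩
      - onesRowsSum (T ∘ inject₁) x′ + rest (T ∘ inject₁)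
        ≈⟨ +-cong (-‿cong (empty x′ (isSingleton-fromℕ T T-single))) (rest-empty (isSingleton-fromℕ T T-single)) ⟩
      - (prefixProd R m m x′ - S) + - S
        ≈⟨ +-congʳ (-‿+-comm _ _) ⟨
      (- prefixProd R m m x′ + - - S) + - S
        ≈⟨ +-assoc _ _ _ ⟩
      - prefixProd R m m x′ + (- - S + - S)
        ≈⟨ +-congˡ (-‿inverseˡ (- S)) ⟩
      - prefixProd R m m x′ + 0#
        ≈⟨ +-identityʳ _ ⟩
      - prefixProd R m m x′
        ≈⟨ -‿cong (prefixProd-init m m x ℕ.≤-refl) ⟨
      - prefixProd R (suc m) m x
        ≡⟨ ≡.cong (λ k → - prefixProd R (suc m) k x) (toℕ-fromℕ m) ⟨
      - prefixProd R (suc m) (toℕ (fromℕ m)) x ∎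
      where
      S : Carrier
      S = ∑[ q < m ] prefixProd R m (suc (toℕ q)) x′
    ... | init-view r′ = begin
      onesRowsSum T x
        ≈⟨ expand-false {T} (proj₂ (isSingleton-inject₁ T T-single)) ⟩
      rest (T ∘ inject₁)
        ≈⟨ rest-singleton (proj₁ (isSingleton-inject₁ T T-single)) ⟩
      - prefixProd R m (toℕ r′) x′
        ≈⟨ -‿cong (prefixProd-init m (toℕ r′) x (ℕ.<⇒≤ (toℕ<n r′))) ⟨
      - prefixProd R (suc m) (toℕ r′) x
        ≡⟨ ≡.cong (λ k → - prefixProd R (suc m) k x) (toℕ-inject₁ r′) ⟨
      - prefixProd R (suc m) (toℕ (inject₁ r′)) x ∎

    onesRowsSum-two : ∀ {T} → HasTwoElements T → onesRowsSum T x ≈ 0#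
    onesRowsSum-two {T} T-two with T (fromℕ m) in Tl
    ... | false = trans (expand-false {T} Tl) (rest-two (hasTwoElements-inject₁ T T-two Tl))
    ... | true with isEmpty⊎isSingleton⊎hasTwoElements (T ∘ inject₁)
    ...   | inj₁ ∅ = let r , Tr = hasTwoElements⇒init-nonempty T T-two in contradiction (≡.trans (≡.sym Tr) (∅ r)) λ ()
    ...   | inj₂ (inj₁ (r , T′-single)) = begin
      onesRowsSum T x
        ≈⟨ expand-true {T} Tl ⟩
      - onesRowsSum (T ∘ inject₁) x′ + rest (T ∘ inject₁)
        ≈⟨ +-cong (-‿cong (singleton x′ T′-single)) (rest-singleton T′-single) ⟩
      - - prefixProd R m (toℕ r) x′ + - prefixProd R m (toℕ r) x′
        ≈⟨ -‿inverseˡ _ ⟩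
      0# ∎
    ...   | inj₂ (inj₂ T′-two) = begin
      onesRowsSum T x
        ≈⟨ expand-true {T} Tl ⟩
      - onesRowsSum (T ∘ inject₁) x′ + rest (T ∘ inject₁)
        ≈⟨ +-cong (-‿cong (two x′ T′-two)) (rest-two T′-two) ⟩
      - 0# + 0#
        ≈⟨ trans (+-identityʳ _) -0#≈0# ⟩
      0# ∎

  onesRowsValues : ∀ m → OnesRowsValues m
  onesRowsValues zero    = onesRowsValues-zero
  onesRowsValues (suc m) = record
    { empty     = λ x → onesRowsSum-empty m (onesRowsValues m) x
    ; singleton = λ x → onesRowsSum-singleton m (onesRowsValues m) x
    ; two       = λ x → onesRowsSum-two m (onesRowsValues m) x
    }

  prodR-EXCi : ∀ {n} (x : Fin n → Carrier) (σ : Fin n → Fin n) → (∀ i → σ i ≢ i) →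
    prodR R (map x (EXCi σ)) ≈ prod (λ i → excedanceMatrix x i (σ i))
  prodR-EXCi {n} x σ no-fixed = begin
    prodR R (map x (EXCi σ))
      ≈⟨ prodR-filter (λ i → i Fin.<? σ i) (allFin n) x ⟩
    prodR R (map (λ i → if does (i Fin.<? σ i) then x i else 1#) (allFin n))
      ≡⟨ prodR-allFin n _ ⟩
    prod (λ i → if does (i Fin.<? σ i) then x i else 1#)
      ≈⟨ prod-cong (λ i → reflexive (factor i)) ⟩
    prod (λ i → excedanceMatrix x i (σ i)) ∎
    where
    factor : ∀ i → (if does (i Fin.<? σ i) then x i else 1#) ≡ excedanceMatrix x i (σ i)
    factor i with <-cmp i (σ i)
    ... | tri< i<σi _ _ = ≡.cong (if_then x i else 1#) (dec-true (i Fin.<? σ i) i<σi)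
    ... | tri≈ _ i≡σi _ = contradiction (≡.sym i≡σi) (no-fixed i)
    ... | tri> i≮σi _ _ = ≡.cong (if_then x i else 1#) (dec-false (i Fin.<? σ i) i≮σi)

  module _ {m} (x : Fin (suc m) → Carrier) (j : Fin m) where

    private
      J : Fin (suc m)
      J = inject₁ j
      x′ : Fin m → Carrier
      x′ = x ∘ inject₁

    -- Row j is x_j e_n, so only permutations with σ(j) = n contribute.
    pinnedMatrix : Matrix (suc m)
    pinnedMatrix = updateAt (excedanceMatrix x) J (const λ k → if does (k ≟ fromℕ m) then x J else 0#)

    private
      W : Matrix (suc m)
      W = pinnedMatrix

      W-J : ∀ k → W J k ≡ (if does (k ≟ fromℕ m) then x J else 0#)
      W-J k = ≡.cong (λ r → r k) (updateAt-updates J (excedanceMatrix x))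

      W-off : ∀ {i} k → i ≢ J → W i k ≡ excedanceMatrix x i k
      W-off {i} k i≢J = ≡.cong (λ r → r k) (updateAt-minimal i J (excedanceMatrix x) i≢J)

      mapsTo⇔ : ∀ (σ : Fin (suc m) → Fin (suc m)) → MapsTo σ (suc (toℕ j)) ⇔ σ J ≡ fromℕ m
      mapsTo⇔ σ = mk⇔
        (λ maps → toℕ-injective (≡.trans (ℕ.suc-injective (maps J (≡.cong suc (toℕ-inject₁ j)))) (≡.sym (toℕ-fromℕ m))))
        (λ σJ i 1+i≡1+j → ≡.subst (λ k → suc (toℕ (σ k)) ≡ suc m)
                            (toℕ-injective (≡.trans (toℕ-inject₁ j) (≡.sym (ℕ.suc-injective 1+i≡1+j))))
                            (≡.trans (≡.cong (suc ∘ toℕ) σJ) (≡.cong suc (toℕ-fromℕ m))))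

    private
      dbarTerm : (Fin (suc m) → Fin (suc m)) → Carrier
      dbarTerm σ = negOnePow R (cyc σ) * prodR R (map x (EXCi σ))

      dbarTerm≈cycleTerm : ∀ {σ} → InDbar (suc (toℕ j)) σ → dbarTerm σ ≈ cycleTerm W σ
      dbarTerm≈cycleTerm {σ} ((_ , no-fixed) , maps) =
        *-congˡ (trans (prodR-EXCi x σ no-fixed) (prod-cong entry))
        where
        σJ : σ J ≡ fromℕ m
        σJ = Equivalence.to (mapsTo⇔ σ) maps
        entry : ∀ i → excedanceMatrix x i (σ i) ≈ W i (σ i)
        entry i with i ≟ J
        ... | no  i≢J    = reflexive (≡.sym (W-off (σ i) i≢J))
        ... | yes ≡.refl = begin
          excedanceMatrix x J (σ J) ≡⟨ ≡.cong (excedanceMatrix x J) σJ ⟩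
          excedanceMatrix x J (fromℕ m) ≡⟨ excedanceMatrix-< x (inject₁<fromℕ j) ⟩
          x J ≡⟨ ≡.cong (if_then x J else 0#) (dec-true (σ J ≟ fromℕ m) σJ) ⟨
          (if does (σ J ≟ fromℕ m) then x J else 0#) ≡⟨ W-J (σ J) ⟨
          W J (σ J) ∎

      cycleTerm-outside-dbar : ∀ {σ} → IsPermutation σ → ¬ InDbar (suc (toℕ j)) σ → cycleTerm W σ ≈ 0#
      cycleTerm-outside-dbar {σ} σ-inj not-dbar = trans (*-congˡ vanishing) (zeroʳ _)
        where
        vanishing : prod (λ i → W i (σ i)) ≈ 0#
        vanishing with σ J ≟ fromℕ m
        ... | no σJ≢last = prod-zero (λ i → W i (σ i)) J
          (reflexive (≡.trans (W-J (σ J)) (≡.cong (if_then x J else 0#) (dec-false (σ J ≟ fromℕ m) σJ≢last))))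
        ... | yes σJ with any? (λ i → σ i ≟ i)
        ...   | no no-fixed = contradiction ((σ-inj , λ i σi≡i → no-fixed (i , σi≡i)) , Equivalence.from (mapsTo⇔ σ) σJ) not-dbar
        ...   | yes (i , σi≡i) = prod-zero (λ i → W i (σ i)) i
          (reflexive (≡.trans (W-off (σ i) i≢J) (≡.trans (≡.cong (excedanceMatrix x i) σi≡i) (excedanceMatrix-diag x i))))
          where
          i≢J : i ≢ J
          i≢J ≡.refl = inject₁≢fromℕ j (≡.trans (≡.sym σi≡i) σJ)

    lhsSum≈cycleSum-pinned : lhsSum R (suc m) (suc (toℕ j)) x ≈ cycleSum pinnedMatrix
    lhsSum≈cycleSum-pinned = begin
      lhsSum R (suc m) (suc (toℕ j)) x
        ≈⟨ ∑ₗ-filter (inDbar? (suc (toℕ j))) (allFuns (suc m) (suc m)) dbarTerm ⟩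
      ∑ₗ (allFuns (suc m) (suc m)) (λ σ → if does (inDbar? (suc (toℕ j)) σ) then dbarTerm σ else 0#)
        ≈⟨ ∑ₗ-cong (allFuns (suc m) (suc m)) term ⟩
      ∑ₗ (allFuns (suc m) (suc m)) (λ σ → if does (isPermutation? σ) then cycleTerm W σ else 0#)
        ≈⟨ ∑ₗ-filter isPermutation? (allFuns (suc m) (suc m)) (cycleTerm W) ⟨
      cycleSum pinnedMatrix ∎
      where
      term : ∀ σ → (if does (inDbar? (suc (toℕ j)) σ) then dbarTerm σ else 0#) ≈ (if does (isPermutation? σ) then cycleTerm W σ else 0#)
      term σ = by-cases (inDbar? (suc (toℕ j)) σ) (isPermutation? σ)
        where
        by-cases : (d : Dec (InDbar (suc (toℕ j)) σ)) (p : Dec (IsPermutation σ)) →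
          (if does d then dbarTerm σ else 0#) ≈ (if does p then cycleTerm W σ else 0#)
        by-cases (yes in-dbar) (yes _)       = dbarTerm≈cycleTerm in-dbar
        by-cases (yes in-dbar) (no not-perm) = contradiction (proj₁ (proj₁ in-dbar)) not-perm
        by-cases (no not-dbar) (yes σ-inj)  = sym (cycleTerm-outside-dbar σ-inj not-dbar)
        by-cases (no _)        (no _)        = refl

    cycleSum-pinned : cycleSum pinnedMatrix ≈ x J * onesRowsSum (updateAt (const false) j (const true)) x′
    cycleSum-pinned = begin
      cycleSum W
        ≈⟨ cycleSum-expand-last m W ⟩
      - W (fromℕ m) (fromℕ m) * cycleSum (dropLast W) + ∑[ q < m ] (W (inject₁ q) (fromℕ m) * cycleSum (insertLast q))
        ≈⟨ +-congʳ (trans (*-congʳ (trans (-‿cong (reflexive corner)) -0#≈0#)) (zeroˡ _)) ⟩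
      0# + ∑[ q < m ] (W (inject₁ q) (fromℕ m) * cycleSum (insertLast q))
        ≈⟨ +-identityˡ _ ⟩
      ∑[ q < m ] (W (inject₁ q) (fromℕ m) * cycleSum (insertLast q))
        ≈⟨ sum-single _ j (λ q q≢j → trans (*-congˡ (cycleSum-zero-row (insertLast q) j (row-j-zero q q≢j))) (zeroʳ _)) ⟩
      W J (fromℕ m) * cycleSum (insertLast j)
        ≈⟨ *-cong (reflexive (≡.trans (W-J (fromℕ m)) (≡.cong (if_then x J else 0#) (dec-true (fromℕ m ≟ fromℕ m) ≡.refl))))
                  (cycleSum-cong λ i k → reflexive (insertOnesRow W (const false) (excedanceMatrix x′) j lastRow-ones agree i k)) ⟩
      x J * onesRowsSum (updateAt (const false) j (const true)) x′ ∎
      where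
      insertLast : Fin m → Matrix m
      insertLast q = updateAt (dropLast W) q (const (lastRow W))
      last≢J : fromℕ m ≢ J
      last≢J = fromℕ≢inject₁
      corner : W (fromℕ m) (fromℕ m) ≡ 0#
      corner = ≡.trans (W-off (fromℕ m) last≢J) (excedanceMatrix-diag x (fromℕ m))
      row-j-zero : ∀ q → q ≢ j → ∀ k → insertLast q j k ≈ 0#
      row-j-zero q q≢j k = reflexive (≡.trans (≡.cong (λ r → r k) (updateAt-minimal j q (dropLast W) (q≢j ∘ ≡.sym)))
        (≡.trans (W-J (inject₁ k)) (≡.cong (if_then x J else 0#) (dec-false (inject₁ k ≟ fromℕ m) (inject₁≢fromℕ k)))))
      lastRow-ones : ∀ k → lastRow W k ≡ 1#
      lastRow-ones k = ≡.trans (W-off (inject₁ k) last≢J) (excedanceMatrix-> x (inject₁<fromℕ k))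
      agree : ∀ i k → i ≢ j → dropLast W i k ≡ withOnesRows (const false) (excedanceMatrix x′) i k
      agree i k i≢j = ≡.trans (W-off (inject₁ k) (i≢j ∘ inject₁-injective)) (excedanceMatrix-inject₁ x i k)

    lhsSum-pinned : lhsSum R (suc m) (suc (toℕ j)) x ≈ - prefixProd R (suc m) (suc (toℕ j)) x
    lhsSum-pinned = begin
      lhsSum R (suc m) (suc (toℕ j)) x
        ≈⟨ lhsSum≈cycleSum-pinned ⟩
      cycleSum pinnedMatrix
        ≈⟨ cycleSum-pinned ⟩
      x J * onesRowsSum (updateAt (const false) j (const true)) x′
        ≈⟨ *-congˡ (OnesRowsValues.singleton (onesRowsValues m) x′ (insert-isEmpty (const false) (λ _ → ≡.refl) j)) ⟩
      x J * - prefixProd R m (toℕ j) x′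
        ≈⟨ -‿distribʳ-* (x J) _ ⟨
      - (x J * prefixProd R m (toℕ j) x′)
        ≈⟨ -‿cong (*-comm (x J) _) ⟩
      - (prefixProd R m (toℕ j) x′ * x′ j)
        ≈⟨ -‿cong (prefixProd-suc m x′ j) ⟨
      - prefixProd R m (suc (toℕ j)) x′
        ≈⟨ -‿cong (prefixProd-init m (suc (toℕ j)) x (toℕ<n j)) ⟨
      - prefixProd R (suc m) (suc (toℕ j)) x ∎

corollary2p5 : ∀ {c ℓ : Level} (R : CommutativeRing c ℓ) (n j : ℕ) → 2 ≤ n → 1 ≤ j → j < n →
    (x : Fin n → CommutativeRing.Carrier R) →
    CommutativeRing._≈_ R (lhsSum R n j x) (CommutativeRing.-_ R (prefixProd R n j x))
corollary2p5 R (suc m) (suc j₀) _ _ (ℕ.s≤s j₀<m) x =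
  -- 2 ≤ n already follows from 1 ≤ j < n
  ≡.subst (λ j → CommutativeRing._≈_ R (lhsSum R (suc m) j x) (CommutativeRing.-_ R (prefixProd R (suc m) j x)))
          (≡.cong suc (toℕ-fromℕ< j₀<m)) (lhsSum-pinned R x (fromℕ< j₀<m))
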